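{- For $n\ge1$ let $\mathcal{F}_n^2$ be the set of forests of $n$ binary shrubs with label set $\{1,\ldots,3n\}$, and for $F=(F_1,\ldots,F_n)\in\mathcal{F}_n^2$ let $\mathrm{risB}(F)=|\{i\in\{1,\dots,n-1\}:F_i<_B F_{i+1}\}|$. Then $$1+\sum_{n\ge1}\frac{t^{3n}}{(3n)!}\sum_{F\in\mathcal{F}_n^2}x^{\mathrm{risB}(F)}=\frac{1-x}{ -x+e^{\frac13(x-1)t^3}}.$$
   Context: A binary shrub is a root with an ordered pair of children (left, right), labeled by distinct positive integers with the root's label smaller than both children's labels. A forest of $n$ binary shrubs with label set $\{1,\ldots,3n\}$ is an ordered sequence of $n$ binary shrubs whose labels together are exactly $\{1,\ldots,3n\}$, each used once. $F<_B G$ means the root label of $F$ is less than the root label of $G$. -}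

module Defs where

open import Data.Bool using (Bool; true; false; if_then_else_)
open import Data.Nat as ℕ using (ℕ; zero; suc; _<ᵇ_; _≡ᵇ_; _!)
open import Data.Nat.Properties using (_!≢0)
open import Data.Product using (_×_; _,_)
open import Data.List as List using (List; []; _∷_; upTo; concatMap; filter; foldr)
open import Data.List.Relation.Unary.All using (All; all?)
open import Data.List.Relation.Unary.Unique.Propositional using (Unique)
open import Data.List.Relation.Unary.Unique.DecPropositional ℕ._≟_ using (unique?)
open import Data.List.Membership.Propositional using (_∈_)
open import Data.List.Membership.DecPropositional ℕ._≟_ using (_∈?_)
open import Data.Vec as Vec using (Vec; []; _∷_; toList)
open import Relation.Nullary using (Dec)
open import Relation.Nullary.Decidable using (_×-dec_)
open import Data.Integer using (+_)
open import Data.Rational using (ℚ; 0ℚ; 1ℚ; _+_; _*_; _-_; _/_)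

-- A binary shrub (root , left , right) with natural-number labels.
Shrub : Set
Shrub = ℕ × ℕ × ℕ

root : Shrub → ℕ
root (r , _ , _) = r

ValidShrub : Shrub → Set
ValidShrub (r , l , s) = (r ℕ.< l) × (r ℕ.< s)

validShrub? : (s : Shrub) → Dec (ValidShrub s)
validShrub? (r , l , s) = (r ℕ.<? l) ×-dec (r ℕ.<? s)

labels : ∀ {n} → Vec Shrub n → List ℕ
labels F = concatMap (λ { (r , l , s) → r ∷ l ∷ s ∷ [] }) (toList F)

range1 : ℕ → List ℕ
range1 m = List.map suc (upTo m)

InRange : ℕ → ℕ → Set
InRange m k = (1 ℕ.≤ k) × (k ℕ.≤ m)

IsForest : (n : ℕ) → Vec Shrub n → Set
IsForest n F =
  All ValidShrub (toList F) ×
  Unique (labels F) ×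
  All (InRange (3 ℕ.* n)) (labels F) ×
  All (_∈ labels F) (range1 (3 ℕ.* n))

isForest? : (n : ℕ) → (F : Vec Shrub n) → Dec (IsForest n F)
isForest? n F =
  all? validShrub? (toList F) ×-dec
  unique? (labels F) ×-dec
  all? (λ k → (1 ℕ.≤? k) ×-dec (k ℕ.≤? 3 ℕ.* n)) (labels F) ×-dec
  all? (_∈? labels F) (range1 (3 ℕ.* n))

vecsOver : {A : Set} → List A → (k : ℕ) → List (Vec A k)
vecsOver xs zero = [] ∷ []
vecsOver xs (suc k) = concatMap (λ x → List.map (x ∷_) (vecsOver xs k)) xs

triples : ℕ → List Shrub
triples m = concatMap (λ r → concatMap (λ l → List.map (λ s → (r , l , s)) (range1 m)) (range1 m)) (range1 m)

forests : (n : ℕ) → List (Vec Shrub n)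
forests n = filter (isForest? n) (vecsOver (triples (3 ℕ.* n)) n)

rises : List ℕ → ℕ
rises (a ∷ b ∷ rest) = (if a <ᵇ b then 1 else 0) ℕ.+ rises (b ∷ rest)
rises _ = 0

risB : ∀ {n} → Vec Shrub n → ℕ
risB F = rises (List.map root (toList F))

_^ℚ_ : ℚ → ℕ → ℚ
x ^ℚ zero = 1ℚ
x ^ℚ suc k = x * (x ^ℚ k)

fromℕℚ : ℕ → ℚ
fromℕℚ k = (+ k) / 1

invFact : ℕ → ℚ
invFact k = (+ 1) / (k !) where instance _ = k !≢0

sumℚ : List ℚ → ℚ
sumℚ = foldr _+_ 0ℚ

forestPoly : ℕ → ℚ → ℚ
forestPoly n x = sumℚ (List.map (λ F → x ^ℚ risB F) (forests n))

-- Coefficients (in t) of both power series, at a rational value of x.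

lhsCoeff : ℚ → ℕ → ℚ
lhsCoeff x zero = 1ℚ
lhsCoeff x (suc m) =
  if (suc m ℕ.% 3) ≡ᵇ 0
  then forestPoly (suc m ℕ./ 3) x * invFact (suc m)
  else 0ℚ

-- -x + exp((x-1) t^3 / 3) ; coefficient of t^m
-- exp((x-1)t^3/3) = Σ_j ((x-1)/3)^j t^{3j} / j!
denCoeff : ℚ → ℕ → ℚ
denCoeff x m =
  (if (m ℕ.% 3) ≡ᵇ 0
   then ((x - 1ℚ) * ((+ 1) / 3)) ^ℚ (m ℕ./ 3) * invFact (m ℕ./ 3)
   else 0ℚ)
  - (if m ≡ᵇ 0 then x else 0ℚ)

cauchy : (ℕ → ℚ) → (ℕ → ℚ) → ℕ → ℚ
cauchy a b m = sumℚ (List.map (λ k → a k * b (m ℕ.∸ k)) (upTo (suc m)))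

numCoeff : ℚ → ℕ → ℚ
numCoeff x zero = 1ℚ - x
numCoeff x (suc m) = 0ℚ

-- Give a forest a virtual preceding root having exactly c of the forest's 3n labels below it.
-- The rise polynomial of such forests depends only on n and c, and peeling off the first shrub,
-- whose children are an ordered pair of the labels above its root, gives a recursion for it
-- (riseSum).  Writing x = 1 + (x - 1) solves the recursion in terms of the forest polynomials a_n:
--   riseSum n c = Σ_j D(3n - c, j) (x - 1)^j a_{n-j},   where D(3j + e, j) = (3j + e)! / (e! 3^j j!).
-- At c = 0 every root rises and the left side is x a_n, so A(t) = Σ a_n t^{3n} / (3n)! satisfies
-- A(t) e^{(x-1)t³/3} = x A(t) + 1 - x, which is the claimed identity.
module Submission where

open import Defs
open import Data.Nat using (ℕ)
open import Data.Rational using (ℚ)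
open import Relation.Binary.PropositionalEquality using (_≡_)

open import Data.Bool using (true; false; if_then_else_)
open import Data.Empty using (⊥-elim)
open import Data.Integer as ℤ using (+_)
import Data.Integer.Properties as ℤP
open import Data.List as List using (List; []; _∷_; map; filter; concatMap; length; _++_)
import Data.List.Properties as List
open import Data.List.Membership.Propositional using (_∈_; _∉_)
open import Data.List.Membership.Propositional.Properties using (∈-filter⁺; ∈-filter⁻; ∈-applyUpTo⁺; ∈-applyUpTo⁻)
open import Data.List.Relation.Unary.All as All using (All; []; _∷_; all?)
open import Data.List.Relation.Unary.AllPairs as AllPairs using (AllPairs; []; _∷_)
import Data.List.Relation.Unary.AllPairs.Properties as AllPairs
open import Data.List.Relation.Unary.Any using (here; there)
open import Data.List.Relation.Unary.Unique.Propositional using (Unique)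
import Data.List.Relation.Unary.Unique.Propositional.Properties as Unique
open import Data.Nat as ℕ using (zero; suc; _<_; _≤_; _<?_; _≟_; z≤n; s≤s; _<ᵇ_; _≤ᵇ_; _!)
open import Data.List.Membership.DecPropositional ℕ._≟_ using (_∈?_)
open import Data.List.Relation.Unary.Unique.DecPropositional ℕ._≟_ using (unique?)
open import Data.Nat.Coprimality using (1-coprimeTo) renaming (sym to coprime-sym)
import Data.Nat.DivMod as DM
import Data.Nat.Properties as ℕP
open import Data.Product using (_×_; _,_; proj₁; proj₂)
open import Data.Rational as ℚ using (mkℚ; 0ℚ; 1ℚ; _+_; _*_; _-_)
import Data.Rational.Properties as ℚP
import Data.Rational.Unnormalised as ℚᵘ
import Data.Rational.Unnormalised.Properties as ℚᵘP
open import Data.Vec using (Vec; []; _∷_; toList)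
open import Function using (_∘_)
open import Level using (0ℓ)
open import Relation.Binary.Definitions using (tri<; tri≈; tri>)
open import Relation.Binary.PropositionalEquality using (_≢_; ≢-sym; refl; sym; trans; cong; cong₂; subst; module ≡-Reasoning)
open import Relation.Nullary using (Dec; yes; no; does; ¬_; ¬?)
open import Relation.Nullary.Decidable using (_×-dec_; dec-true; dec-false)
open import Relation.Unary using (Pred; Decidable)

fromℕ : ℕ → ℚ
fromℕ n = mkℚ (+ n) 0 (coprime-sym (1-coprimeTo n))

fromℕ-+ : ∀ m n → fromℕ (m ℕ.+ n) ≡ fromℕ m + fromℕ n
fromℕ-+ m n = sym (ℚP.toℚᵘ-injective (ℚᵘP.≃-trans (ℚP.toℚᵘ-homo-+ (fromℕ m) (fromℕ n)) (ℚᵘ.*≡* eq)))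
  where
  eq : (+ m ℤ.* + 1 ℤ.+ + n ℤ.* + 1) ℤ.* + 1 ≡ + (m ℕ.+ n) ℤ.* (+ 1 ℤ.* + 1)
  eq = trans (ℤP.*-identityʳ _)
    (trans (cong₂ ℤ._+_ (ℤP.*-identityʳ (+ m)) (ℤP.*-identityʳ (+ n))) (sym (ℤP.*-identityʳ _)))

fromℕ-* : ∀ m n → fromℕ (m ℕ.* n) ≡ fromℕ m * fromℕ n
fromℕ-* m n = sym (ℚP.toℚᵘ-injective (ℚᵘP.≃-trans (ℚP.toℚᵘ-homo-* (fromℕ m) (fromℕ n)) (ℚᵘ.*≡* eq)))
  where
  eq : (+ m ℤ.* + n) ℤ.* + 1 ≡ + (m ℕ.* n) ℤ.* (+ 1 ℤ.* + 1)
  eq = trans (ℤP.*-identityʳ (+ m ℤ.* + n)) (sym (trans (ℤP.*-identityʳ (+ (m ℕ.* n))) (ℤP.pos-* m n)))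

Σℕ : ℕ → (ℕ → ℕ) → ℕ
Σℕ zero    f = 0
Σℕ (suc n) f = Σℕ n f ℕ.+ f n

Σℕ-cong : ∀ n {f g} → (∀ i → i < n → f i ≡ g i) → Σℕ n f ≡ Σℕ n g
Σℕ-cong zero    f≡g = refl
Σℕ-cong (suc n) f≡g = cong₂ ℕ._+_ (Σℕ-cong n (λ i i<n → f≡g i (ℕP.m<n⇒m<1+n i<n))) (f≡g n ℕP.≤-refl)

Σℕ-zero : ∀ n {f} → (∀ i → i < n → f i ≡ 0) → Σℕ n f ≡ 0
Σℕ-zero zero    f≡0 = refl
Σℕ-zero (suc n) f≡0 = cong₂ ℕ._+_ (Σℕ-zero n (λ i i<n → f≡0 i (ℕP.m<n⇒m<1+n i<n))) (f≡0 n ℕP.≤-refl)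

Σℕ-sucˡ : ∀ n f → Σℕ (suc n) f ≡ f 0 ℕ.+ Σℕ n (λ i → f (suc i))
Σℕ-sucˡ zero    f = ℕP.+-comm 0 (f 0)
Σℕ-sucˡ (suc n) f = trans (cong (ℕ._+ f (suc n)) (Σℕ-sucˡ n f)) (ℕP.+-assoc (f 0) _ _)

𝟙[_≤_] : ℕ → ℕ → ℕ
𝟙[ c ≤ i ] = if c ≤ᵇ i then 1 else 0

≤ᵇ-suc : ∀ m n → (suc m ≤ᵇ suc n) ≡ (m ≤ᵇ n)
≤ᵇ-suc zero    n = refl
≤ᵇ-suc (suc m) n = refl

Σℕ-reverse-≥ : ∀ M c h → Σℕ M (λ i → 𝟙[ c ≤ i ] ℕ.* h (M ℕ.∸ suc i)) ≡ Σℕ (M ℕ.∸ c) h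
Σℕ-reverse-≥ zero    zero    h = refl
Σℕ-reverse-≥ zero    (suc c) h = refl
Σℕ-reverse-≥ (suc M) zero    h = begin
    Σℕ (suc M) (λ i → 𝟙[ 0 ≤ i ] ℕ.* h (suc M ℕ.∸ suc i))
  ≡⟨ Σℕ-sucˡ M _ ⟩
    1 ℕ.* h M ℕ.+ Σℕ M (λ i → 𝟙[ 0 ≤ suc i ] ℕ.* h (M ℕ.∸ suc i))
  ≡⟨ cong₂ ℕ._+_ (ℕP.*-identityˡ (h M)) (Σℕ-reverse-≥ M zero h) ⟩
    h M ℕ.+ Σℕ M h
  ≡⟨ ℕP.+-comm (h M) _ ⟩
    Σℕ (suc M) h ∎
  where open ≡-Reasoning
Σℕ-reverse-≥ (suc M) (suc c) h = trans (Σℕ-sucˡ M _)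
  (trans (Σℕ-cong M (λ i _ → cong (λ b → (if b then 1 else 0) ℕ.* h (M ℕ.∸ suc i)) (≤ᵇ-suc c i)))
         (Σℕ-reverse-≥ M c h))

-- Counting sets of disjoint shrubs

orderedPairs : ℕ → ℕ
orderedPairs k = k ℕ.* (k ℕ.∸ 1)

-- shrubCount N j is the number of sets of j disjoint binary shrubs on N given labels,
-- counted by the number k of labels above the smallest root.
shrubCount : ℕ → ℕ → ℕ
shrubCount N zero    = 1
shrubCount N (suc j) = Σℕ N (λ k → orderedPairs k ℕ.* shrubCount (k ℕ.∸ 2) j)

shrubCount-< : ∀ j N → N < 3 ℕ.* j → shrubCount N j ≡ 0
shrubCount-< (suc j) N N<3j+3 =
  Σℕ-zero N (λ k k<N → summand-zero k (ℕP.≤-trans k<N (ℕP.≤-pred (ℕP.≤-trans N<3j+3 (ℕP.≤-reflexive (ℕP.*-suc 3 j))))))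
  where
  summand-zero : ∀ k → k < suc (suc (3 ℕ.* j)) → orderedPairs k ℕ.* shrubCount (k ℕ.∸ 2) j ≡ 0
  summand-zero zero                _          = refl
  summand-zero (suc zero)          _          = refl
  summand-zero (suc (suc k)) (s≤s (s≤s k<3j)) =
    trans (cong (orderedPairs (suc (suc k)) ℕ.*_) (shrubCount-< j k k<3j)) (ℕP.*-zeroʳ (orderedPairs (suc (suc k))))

module _ where
  open import Data.Nat.Solver using (module +-*-Solver)
  open +-*-Solver

  shrubCount-closed-suc : ∀ j → (∀ e → shrubCount (3 ℕ.* j ℕ.+ e) j ℕ.* (e ! ℕ.* (3 ℕ.^ j ℕ.* j !)) ≡ (3 ℕ.* j ℕ.+ e) !) →
    ∀ e → shrubCount (3 ℕ.+ (3 ℕ.* j ℕ.+ e)) (suc j) ℕ.* (e ! ℕ.* (3 ℕ.^ suc j ℕ.* suc j !)) ≡ (3 ℕ.+ (3 ℕ.* j ℕ.+ e)) !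
  shrubCount-closed-suc j IH zero = begin
      (shrubCount (2 ℕ.+ m) (suc j) ℕ.+ orderedPairs (2 ℕ.+ m) ℕ.* shrubCount m j) ℕ.* (1 ℕ.* (3 ℕ.^ suc j ℕ.* suc j !))
    ≡⟨ cong (λ z → (z ℕ.+ orderedPairs (2 ℕ.+ m) ℕ.* shrubCount m j) ℕ.* (1 ℕ.* (3 ℕ.^ suc j ℕ.* suc j !)))
            (shrubCount-< (suc j) (2 ℕ.+ m) (ℕP.≤-reflexive (trans (cong (3 ℕ.+_) (ℕP.+-identityʳ (3 ℕ.* j))) (sym (ℕP.*-suc 3 j))))) ⟩
      (0 ℕ.+ (2 ℕ.+ m) ℕ.* (1 ℕ.+ m) ℕ.* shrubCount m j) ℕ.* (1 ℕ.* (3 ℕ.^ suc j ℕ.* suc j !))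
    ≡⟨ solve 5 (λ j D m! p j! → (con 0 :+ (con 2 :+ (con 3 :* j :+ con 0)) :* (con 1 :+ (con 3 :* j :+ con 0)) :* D)
                                  :* (con 1 :* ((con 3 :* p) :* ((con 1 :+ j) :* j!)))
            := (con 3 :+ (con 3 :* j :+ con 0)) :* ((con 2 :+ (con 3 :* j :+ con 0)) :* ((con 1 :+ (con 3 :* j :+ con 0)) :* (D :* (con 1 :* (p :* j!))))))
            refl j (shrubCount m j) (m !) (3 ℕ.^ j) (j !) ⟩
      (3 ℕ.+ m) ℕ.* ((2 ℕ.+ m) ℕ.* ((1 ℕ.+ m) ℕ.* (shrubCount m j ℕ.* (1 ℕ.* (3 ℕ.^ j ℕ.* j !)))))
    ≡⟨ cong (λ z → (3 ℕ.+ m) ℕ.* ((2 ℕ.+ m) ℕ.* ((1 ℕ.+ m) ℕ.* z))) (IH 0) ⟩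
      (3 ℕ.+ m) !
    ∎
    where
    open ≡-Reasoning
    m = 3 ℕ.* j ℕ.+ 0
  shrubCount-closed-suc j IH (suc e) = begin
      shrubCount (3 ℕ.+ (3 ℕ.* j ℕ.+ suc e)) (suc j) ℕ.* (suc e ! ℕ.* P)
    ≡⟨ cong (λ z → shrubCount (3 ℕ.+ z) (suc j) ℕ.* (suc e ! ℕ.* P)) (ℕP.+-suc (3 ℕ.* j) e) ⟩
      (shrubCount (3 ℕ.+ m) (suc j) ℕ.+ orderedPairs (3 ℕ.+ m) ℕ.* shrubCount (suc m) j) ℕ.* (suc e ! ℕ.* P)
    ≡⟨ solve 8 (λ A B m e e! p j! j → (A :+ (con 3 :+ m) :* (con 2 :+ m) :* B) :* (((con 1 :+ e) :* e!) :* ((con 3 :* p) :* ((con 1 :+ j) :* j!)))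
            := (con 1 :+ e) :* (A :* (e! :* ((con 3 :* p) :* ((con 1 :+ j) :* j!))))
               :+ (con 3 :+ m) :* (con 2 :+ m) :* (con 3 :* (con 1 :+ j)) :* (B :* (((con 1 :+ e) :* e!) :* (p :* j!))))
            refl (shrubCount (3 ℕ.+ m) (suc j)) (shrubCount (suc m) j) m e (e !) (3 ℕ.^ j) (j !) j ⟩
      (1 ℕ.+ e) ℕ.* (shrubCount (3 ℕ.+ m) (suc j) ℕ.* (e ! ℕ.* P))
        ℕ.+ (3 ℕ.+ m) ℕ.* (2 ℕ.+ m) ℕ.* (3 ℕ.* (1 ℕ.+ j)) ℕ.* (shrubCount (suc m) j ℕ.* (suc e ! ℕ.* (3 ℕ.^ j ℕ.* j !)))
    ≡⟨ cong₂ (λ u v → (1 ℕ.+ e) ℕ.* u ℕ.+ (3 ℕ.+ m) ℕ.* (2 ℕ.+ m) ℕ.* (3 ℕ.* (1 ℕ.+ j)) ℕ.* v)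
             (shrubCount-closed-suc j IH e)
             (subst (λ z → shrubCount z j ℕ.* (suc e ! ℕ.* (3 ℕ.^ j ℕ.* j !)) ≡ z !) (ℕP.+-suc (3 ℕ.* j) e) (IH (suc e))) ⟩
      (1 ℕ.+ e) ℕ.* (3 ℕ.+ m) ! ℕ.+ (3 ℕ.+ m) ℕ.* (2 ℕ.+ m) ℕ.* (3 ℕ.* (1 ℕ.+ j)) ℕ.* (suc m) !
    ≡⟨ solve 4 (λ m e j m! → (con 1 :+ e) :* ((con 3 :+ m) :* ((con 2 :+ m) :* ((con 1 :+ m) :* m!)))
                              :+ (con 3 :+ m) :* (con 2 :+ m) :* (con 3 :* (con 1 :+ j)) :* ((con 1 :+ m) :* m!)
            := (con 4 :+ (con 3 :* j :+ e)) :* ((con 3 :+ m) :* ((con 2 :+ m) :* ((con 1 :+ m) :* m!)))) refl m e j (m !) ⟩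
      (4 ℕ.+ (3 ℕ.* j ℕ.+ e)) ℕ.* (3 ℕ.+ m) !
    ≡⟨ cong (λ z → (3 ℕ.+ z) !) (sym (ℕP.+-suc (3 ℕ.* j) e)) ⟩
      (3 ℕ.+ (3 ℕ.* j ℕ.+ suc e)) !
    ∎
    where
    open ≡-Reasoning
    m = 3 ℕ.* j ℕ.+ e
    P = 3 ℕ.^ suc j ℕ.* suc j !

shrubCount-closed : ∀ j e → shrubCount (3 ℕ.* j ℕ.+ e) j ℕ.* (e ! ℕ.* (3 ℕ.^ j ℕ.* j !)) ≡ (3 ℕ.* j ℕ.+ e) !
shrubCount-closed zero    e = trans (ℕP.*-identityˡ _) (ℕP.*-identityʳ (e !))
shrubCount-closed (suc j) e =
  subst (λ N → shrubCount (N ℕ.+ e) (suc j) ℕ.* (e ! ℕ.* (3 ℕ.^ suc j ℕ.* suc j !)) ≡ (N ℕ.+ e) !)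
        (sym (ℕP.*-suc 3 j)) (shrubCount-closed-suc j (shrubCount-closed j) e)

open import Data.Rational.Solver using (module +-*-Solver)
open +-*-Solver

Σ : ℕ → (ℕ → ℚ) → ℚ
Σ zero    f = 0ℚ
Σ (suc n) f = Σ n f + f n

fromℕ-Σℕ : ∀ n f → fromℕ (Σℕ n f) ≡ Σ n (λ i → fromℕ (f i))
fromℕ-Σℕ zero    f = refl
fromℕ-Σℕ (suc n) f = trans (fromℕ-+ (Σℕ n f) (f n)) (cong (_+ fromℕ (f n)) (fromℕ-Σℕ n f))

Σ-cong : ∀ n {f g} → (∀ i → i < n → f i ≡ g i) → Σ n f ≡ Σ n g
Σ-cong zero    f≡g = refl
Σ-cong (suc n) f≡g = cong₂ _+_ (Σ-cong n (λ i i<n → f≡g i (ℕP.m<n⇒m<1+n i<n))) (f≡g n ℕP.≤-refl)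

Σ-zero : ∀ n {f} → (∀ i → i < n → f i ≡ 0ℚ) → Σ n f ≡ 0ℚ
Σ-zero zero    f≡0 = refl
Σ-zero (suc n) f≡0 = trans (cong₂ _+_ (Σ-zero n (λ i i<n → f≡0 i (ℕP.m<n⇒m<1+n i<n))) (f≡0 n ℕP.≤-refl)) (ℚP.+-identityʳ 0ℚ)

Σ-+ : ∀ n f g → Σ n (λ i → f i + g i) ≡ Σ n f + Σ n g
Σ-+ zero    f g = sym (ℚP.+-identityʳ 0ℚ)
Σ-+ (suc n) f g = trans (cong (_+ (f n + g n)) (Σ-+ n f g))
  (solve 4 (λ a b c d → (a :+ b) :+ (c :+ d) := (a :+ c) :+ (b :+ d)) refl (Σ n f) (Σ n g) (f n) (g n))

Σ-- : ∀ n f g → Σ n (λ i → f i - g i) ≡ Σ n f - Σ n g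
Σ-- zero    f g = refl
Σ-- (suc n) f g = trans (cong (_+ (f n - g n)) (Σ-- n f g))
  (solve 4 (λ a b c d → (a :- b) :+ (c :- d) := (a :+ c) :- (b :+ d)) refl (Σ n f) (Σ n g) (f n) (g n))

Σ-*ˡ : ∀ n c f → c * Σ n f ≡ Σ n (λ i → c * f i)
Σ-*ˡ zero    c f = ℚP.*-zeroʳ c
Σ-*ˡ (suc n) c f = trans (ℚP.*-distribˡ-+ c (Σ n f) (f n)) (cong (_+ c * f n) (Σ-*ˡ n c f))

Σ-*ʳ : ∀ n c f → Σ n f * c ≡ Σ n (λ i → f i * c)
Σ-*ʳ n c f = trans (ℚP.*-comm (Σ n f) c) (trans (Σ-*ˡ n c f) (Σ-cong n (λ i _ → ℚP.*-comm c (f i))))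

Σ-sucˡ : ∀ n f → Σ (suc n) f ≡ f 0 + Σ n (λ i → f (suc i))
Σ-sucˡ zero    f = trans (ℚP.+-identityˡ (f 0)) (sym (ℚP.+-identityʳ (f 0)))
Σ-sucˡ (suc n) f = trans (cong (_+ f (suc n)) (Σ-sucˡ n f)) (ℚP.+-assoc (f 0) _ _)

Σ-comm : ∀ n m (f : ℕ → ℕ → ℚ) → Σ n (λ i → Σ m (f i)) ≡ Σ m (λ j → Σ n (λ i → f i j))
Σ-comm zero    m f = sym (Σ-zero m (λ _ _ → refl))
Σ-comm (suc n) m f = trans (cong (_+ Σ m (f n)) (Σ-comm n m f)) (sym (Σ-+ m (λ j → Σ n (λ i → f i j)) (f n)))

Σ-reverse : ∀ n f → Σ n f ≡ Σ n (λ j → f (n ℕ.∸ suc j))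
Σ-reverse zero    f = refl
Σ-reverse (suc n) f = trans (cong (_+ f n) (Σ-reverse n f))
  (trans (ℚP.+-comm _ (f n)) (sym (Σ-sucˡ n (λ j → f (suc n ℕ.∸ suc j)))))

Σ-lacunary : ∀ q f → (∀ n → f (suc (3 ℕ.* n)) ≡ 0ℚ) → (∀ n → f (suc (suc (3 ℕ.* n))) ≡ 0ℚ) →
             Σ (3 ℕ.* q) f ≡ Σ q (λ n → f (3 ℕ.* n))
Σ-lacunary zero    f f₁≡0 f₂≡0 = refl
Σ-lacunary (suc q) f f₁≡0 f₂≡0 = begin
    Σ (3 ℕ.* suc q) f
  ≡⟨ cong (λ k → Σ k f) (ℕP.*-suc 3 q) ⟩
    ((Σ (3 ℕ.* q) f + f (3 ℕ.* q)) + f (suc (3 ℕ.* q))) + f (suc (suc (3 ℕ.* q)))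
  ≡⟨ cong₂ (λ u v → ((Σ (3 ℕ.* q) f + f (3 ℕ.* q)) + u) + v) (f₁≡0 q) (f₂≡0 q) ⟩
    ((Σ (3 ℕ.* q) f + f (3 ℕ.* q)) + 0ℚ) + 0ℚ
  ≡⟨ trans (ℚP.+-identityʳ _) (ℚP.+-identityʳ _) ⟩
    Σ (3 ℕ.* q) f + f (3 ℕ.* q)
  ≡⟨ cong (_+ f (3 ℕ.* q)) (Σ-lacunary q f f₁≡0 f₂≡0) ⟩
    Σ (suc q) (λ n → f (3 ℕ.* n)) ∎
  where open ≡-Reasoning

sumℚ-map-applyUpTo : ∀ n (h : ℕ → ℚ) (φ : ℕ → ℕ) → sumℚ (List.map h (List.applyUpTo φ n)) ≡ Σ n (λ i → h (φ i))
sumℚ-map-applyUpTo zero    h φ = refl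
sumℚ-map-applyUpTo (suc n) h φ =
  trans (cong (λ z → h (φ 0) + z) (sumℚ-map-applyUpTo n h (λ i → φ (suc i)))) (sym (Σ-sucˡ n (λ i → h (φ i))))

inverse-unique : ∀ u v e → u * e ≡ 1ℚ → v * e ≡ 1ℚ → u ≡ v
inverse-unique u v e ue≡1 ve≡1 = begin
  u            ≡⟨ sym (ℚP.*-identityʳ u) ⟩
  u * 1ℚ       ≡⟨ cong (u *_) (sym ve≡1) ⟩
  u * (v * e)  ≡⟨ solve 3 (λ u v e → u :* (v :* e) := v :* (u :* e)) refl u v e ⟩
  v * (u * e)  ≡⟨ cong (v *_) ue≡1 ⟩
  v * 1ℚ       ≡⟨ ℚP.*-identityʳ v ⟩
  v            ∎
  where open ≡-Reasoning

reciprocal-fromℕ : ∀ d .{{_ : ℕ.NonZero d}} → (+ 1 ℚ./ d) * fromℕ d ≡ 1ℚ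
reciprocal-fromℕ (suc d) = trans (cong (_* fromℕ (suc d)) (ℚP.normalize-coprime (1-coprimeTo (suc d)))) (ℚP.*-inverseˡ (fromℕ (suc d)))

invFact-inverse : ∀ n → invFact n * fromℕ (n !) ≡ 1ℚ
invFact-inverse n = reciprocal-fromℕ (n !) {{n ℕP.!≢0}}

^ℚ-distrib-* : ∀ a b j → (a * b) ^ℚ j ≡ a ^ℚ j * b ^ℚ j
^ℚ-distrib-* a b zero    = refl
^ℚ-distrib-* a b (suc j) = trans (cong ((a * b) *_) (^ℚ-distrib-* a b j))
  (solve 4 (λ a b c d → (a :* b) :* (c :* d) := (a :* c) :* (b :* d)) refl a b (a ^ℚ j) (b ^ℚ j))

^ℚ-+ : ∀ a m n → a ^ℚ (m ℕ.+ n) ≡ a ^ℚ m * a ^ℚ n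
^ℚ-+ a zero    n = sym (ℚP.*-identityˡ (a ^ℚ n))
^ℚ-+ a (suc m) n = trans (cong (a *_) (^ℚ-+ a m n)) (sym (ℚP.*-assoc a (a ^ℚ m) (a ^ℚ n)))

fromℕ-^ : ∀ d j → fromℕ (d ℕ.^ j) ≡ fromℕ d ^ℚ j
fromℕ-^ d zero    = refl
fromℕ-^ d (suc j) = trans (fromℕ-* d (d ℕ.^ j)) (cong (fromℕ d *_) (fromℕ-^ d j))

1^ℚ : ∀ j → 1ℚ ^ℚ j ≡ 1ℚ
1^ℚ zero    = refl
1^ℚ (suc j) = trans (ℚP.*-identityˡ (1ℚ ^ℚ j)) (1^ℚ j)

reciprocal-fromℕ-^ : ∀ d .{{_ : ℕ.NonZero d}} j → (+ 1 ℚ./ d) ^ℚ j * fromℕ (d ℕ.^ j) ≡ 1ℚ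
reciprocal-fromℕ-^ d j = begin
  (+ 1 ℚ./ d) ^ℚ j * fromℕ (d ℕ.^ j)     ≡⟨ cong ((+ 1 ℚ./ d) ^ℚ j *_) (fromℕ-^ d j) ⟩
  (+ 1 ℚ./ d) ^ℚ j * fromℕ d ^ℚ j        ≡⟨ sym (^ℚ-distrib-* (+ 1 ℚ./ d) (fromℕ d) j) ⟩
  ((+ 1 ℚ./ d) * fromℕ d) ^ℚ j           ≡⟨ cong (_^ℚ j) (reciprocal-fromℕ d) ⟩
  1ℚ ^ℚ j                                ≡⟨ 1^ℚ j ⟩
  1ℚ                                     ∎
  where open ≡-Reasoning

-- Both sides are inverse to (3(q - j))! 3^j j!, the left one by shrubCount-closed.
invFact-shrubCount : ∀ q j → j ℕ.≤ q →
  invFact (3 ℕ.* q) * fromℕ (shrubCount (3 ℕ.* q) j) ≡ invFact (3 ℕ.* (q ℕ.∸ j)) * ((+ 1 ℚ./ 3) ^ℚ j * invFact j)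
invFact-shrubCount q j j≤q = inverse-unique _ _ (fromℕ (e ! ℕ.* (3 ℕ.^ j ℕ.* j !))) lhs-inverse rhs-inverse
  where
  open ≡-Reasoning
  e = 3 ℕ.* (q ℕ.∸ j)
  3q≡3j+e : 3 ℕ.* q ≡ 3 ℕ.* j ℕ.+ e
  3q≡3j+e = trans (cong (3 ℕ.*_) (sym (ℕP.m+[n∸m]≡n j≤q))) (ℕP.*-distribˡ-+ 3 j (q ℕ.∸ j))
  lhs-inverse : invFact (3 ℕ.* q) * fromℕ (shrubCount (3 ℕ.* q) j) * fromℕ (e ! ℕ.* (3 ℕ.^ j ℕ.* j !)) ≡ 1ℚ
  lhs-inverse = begin
      invFact (3 ℕ.* q) * fromℕ (shrubCount (3 ℕ.* q) j) * fromℕ (e ! ℕ.* (3 ℕ.^ j ℕ.* j !))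
    ≡⟨ trans (ℚP.*-assoc (invFact (3 ℕ.* q)) (fromℕ (shrubCount (3 ℕ.* q) j)) (fromℕ (e ! ℕ.* (3 ℕ.^ j ℕ.* j !))))
              (cong (invFact (3 ℕ.* q) *_) (sym (fromℕ-* (shrubCount (3 ℕ.* q) j) (e ! ℕ.* (3 ℕ.^ j ℕ.* j !))))) ⟩
      invFact (3 ℕ.* q) * fromℕ (shrubCount (3 ℕ.* q) j ℕ.* (e ! ℕ.* (3 ℕ.^ j ℕ.* j !)))
    ≡⟨ cong (λ N → invFact N * fromℕ (shrubCount N j ℕ.* (e ! ℕ.* (3 ℕ.^ j ℕ.* j !)))) 3q≡3j+e ⟩
      invFact (3 ℕ.* j ℕ.+ e) * fromℕ (shrubCount (3 ℕ.* j ℕ.+ e) j ℕ.* (e ! ℕ.* (3 ℕ.^ j ℕ.* j !)))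
    ≡⟨ cong (λ z → invFact (3 ℕ.* j ℕ.+ e) * fromℕ z) (shrubCount-closed j e) ⟩
      invFact (3 ℕ.* j ℕ.+ e) * fromℕ ((3 ℕ.* j ℕ.+ e) !)
    ≡⟨ invFact-inverse (3 ℕ.* j ℕ.+ e) ⟩
      1ℚ
    ∎
  rhs-inverse : invFact e * ((+ 1 ℚ./ 3) ^ℚ j * invFact j) * fromℕ (e ! ℕ.* (3 ℕ.^ j ℕ.* j !)) ≡ 1ℚ
  rhs-inverse = begin
      invFact e * ((+ 1 ℚ./ 3) ^ℚ j * invFact j) * fromℕ (e ! ℕ.* (3 ℕ.^ j ℕ.* j !))
    ≡⟨ cong (invFact e * ((+ 1 ℚ./ 3) ^ℚ j * invFact j) *_)
            (trans (fromℕ-* (e !) _) (cong (fromℕ (e !) *_) (fromℕ-* (3 ℕ.^ j) (j !)))) ⟩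
      invFact e * ((+ 1 ℚ./ 3) ^ℚ j * invFact j) * (fromℕ (e !) * (fromℕ (3 ℕ.^ j) * fromℕ (j !)))
    ≡⟨ solve 6 (λ a b c d f g → a :* (b :* c) :* (d :* (f :* g)) := (a :* d) :* ((b :* f) :* (c :* g))) refl
         (invFact e) ((+ 1 ℚ./ 3) ^ℚ j) (invFact j) (fromℕ (e !)) (fromℕ (3 ℕ.^ j)) (fromℕ (j !)) ⟩
      (invFact e * fromℕ (e !)) * (((+ 1 ℚ./ 3) ^ℚ j * fromℕ (3 ℕ.^ j)) * (invFact j * fromℕ (j !)))
    ≡⟨ cong₂ _*_ (invFact-inverse e) (cong₂ _*_ (reciprocal-fromℕ-^ 3 j) (invFact-inverse j)) ⟩
      1ℚ
    ∎

𝟙 : ∀ {P : Set} → Dec P → ℚ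
𝟙 P? = if does P? then 1ℚ else 0ℚ

𝟙-⇔ : ∀ {A B : Set} → (A → B) → (B → A) → (A? : Dec A) (B? : Dec B) → 𝟙 A? ≡ 𝟙 B?
𝟙-⇔ f g (yes a) (yes b) = refl
𝟙-⇔ f g (yes a) (no ¬b) = ⊥-elim (¬b (f a))
𝟙-⇔ f g (no ¬a) (yes b) = ⊥-elim (¬a (g b))
𝟙-⇔ f g (no ¬a) (no ¬b) = refl

𝟙-yes : ∀ {A : Set} → A → (A? : Dec A) → 𝟙 A? ≡ 1ℚ
𝟙-yes a A? = cong (λ b → if b then 1ℚ else 0ℚ) (dec-true A? a)

𝟙-no : ∀ {A : Set} → ¬ A → (A? : Dec A) → 𝟙 A? ≡ 0ℚ
𝟙-no ¬a A? = cong (λ b → if b then 1ℚ else 0ℚ) (dec-false A? ¬a)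

𝟙-× : ∀ {A B : Set} (A? : Dec A) (B? : Dec B) → 𝟙 (A? ×-dec B?) ≡ 𝟙 A? * 𝟙 B?
𝟙-× (yes _) (yes _) = refl
𝟙-× (yes _) (no _)  = refl
𝟙-× (no _)  (yes _) = refl
𝟙-× (no _)  (no _)  = refl

sumMap : ∀ {A : Set} → (A → ℚ) → List A → ℚ
sumMap f xs = sumℚ (map f xs)

sumMap-cong : ∀ {A : Set} (xs : List A) {f g : A → ℚ} → (∀ z → z ∈ xs → f z ≡ g z) → sumMap f xs ≡ sumMap g xs
sumMap-cong []       f≡g = refl
sumMap-cong (x ∷ xs) f≡g = cong₂ _+_ (f≡g x (here refl)) (sumMap-cong xs (λ z z∈ → f≡g z (there z∈)))

sumMap-++ : ∀ {A : Set} (f : A → ℚ) xs ys → sumMap f (xs ++ ys) ≡ sumMap f xs + sumMap f ys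
sumMap-++ f []       ys = sym (ℚP.+-identityˡ _)
sumMap-++ f (x ∷ xs) ys = trans (cong (λ z → f x + z) (sumMap-++ f xs ys)) (sym (ℚP.+-assoc (f x) _ _))

sumMap-concatMap : ∀ {A B : Set} (f : B → ℚ) (h : A → List B) xs →
                   sumMap f (concatMap h xs) ≡ sumMap (λ t → sumMap f (h t)) xs
sumMap-concatMap f h []       = refl
sumMap-concatMap f h (x ∷ xs) =
  trans (sumMap-++ f (h x) (concatMap h xs)) (cong (λ z → sumMap f (h x) + z) (sumMap-concatMap f h xs))

sumMap-map : ∀ {A B : Set} (f : B → ℚ) (g : A → B) xs → sumMap f (map g xs) ≡ sumMap (f ∘ g) xs
sumMap-map f g []       = refl
sumMap-map f g (x ∷ xs) = cong (λ z → f (g x) + z) (sumMap-map f g xs)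

sumMap-*ˡ : ∀ {A : Set} c (f : A → ℚ) xs → c * sumMap f xs ≡ sumMap (λ z → c * f z) xs
sumMap-*ˡ c f []       = ℚP.*-zeroʳ c
sumMap-*ˡ c f (x ∷ xs) = trans (ℚP.*-distribˡ-+ c (f x) _) (cong (λ z → c * f x + z) (sumMap-*ˡ c f xs))

sumMap-*ʳ : ∀ {A : Set} c (f : A → ℚ) xs → sumMap f xs * c ≡ sumMap (λ z → f z * c) xs
sumMap-*ʳ c f xs = trans (ℚP.*-comm _ c) (trans (sumMap-*ˡ c f xs) (sumMap-cong xs (λ z _ → ℚP.*-comm c (f z))))

sumMap-filter : ∀ {A : Set} {P : Pred A 0ℓ} (P? : Decidable P) (f : A → ℚ) xs →
                sumMap f (filter P? xs) ≡ sumMap (λ z → if does (P? z) then f z else 0ℚ) xs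
sumMap-filter P? f [] = refl
sumMap-filter P? f (x ∷ xs) with does (P? x)
... | true  = cong (λ z → f x + z) (sumMap-filter P? f xs)
... | false = trans (sumMap-filter P? f xs) (sym (ℚP.+-identityˡ _))

remove : ℕ → List ℕ → List ℕ
remove a = filter (λ z → ¬? (z ≟ a))

∈-remove⁻ : ∀ {a z L} → z ∈ remove a L → z ∈ L × z ≢ a
∈-remove⁻ {a} = ∈-filter⁻ (λ z → ¬? (z ≟ a))

∈-remove⁺ : ∀ {a z L} → z ∈ L → z ≢ a → z ∈ remove a L
∈-remove⁺ {a} = ∈-filter⁺ (λ z → ¬? (z ≟ a))

remove-∷-self : ∀ a L → a ∉ L → remove a (a ∷ L) ≡ L
remove-∷-self a L a∉L = trans (List.filter-reject (λ z → ¬? (z ≟ a)) (λ a≢a → a≢a refl))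
  (List.filter-all (λ z → ¬? (z ≟ a)) (All.tabulate (λ z∈L z≡a → a∉L (subst (_∈ L) z≡a z∈L))))

remove-∷-other : ∀ a b L → b ≢ a → remove a (b ∷ L) ≡ b ∷ remove a L
remove-∷-other a b L = List.filter-accept (λ z → ¬? (z ≟ a))

sumMap-remove : ∀ (g : ℕ → ℚ) {a} L → Unique L → a ∈ L → sumMap g L ≡ g a + sumMap g (remove a L)
sumMap-remove g {a} (b ∷ L) (b∉L ∷ L!) a∈ with b ≟ a | a∈
... | yes refl | _         = cong (λ z → g b + sumMap g z) (sym (remove-∷-self b L (λ b∈L → All.lookup b∉L b∈L refl)))
... | no b≢a   | here a≡b  = ⊥-elim (b≢a (sym a≡b))
... | no b≢a   | there a∈L = begin
    g b + sumMap g L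
  ≡⟨ cong (λ z → g b + z) (sumMap-remove g L L! a∈L) ⟩
    g b + (g a + sumMap g (remove a L))
  ≡⟨ solve 3 (λ p q r → p :+ (q :+ r) := q :+ (p :+ r)) refl (g b) (g a) (sumMap g (remove a L)) ⟩
    g a + (g b + sumMap g (remove a L))
  ≡⟨ cong (λ z → g a + sumMap g z) (sym (remove-∷-other a b L b≢a)) ⟩
    g a + sumMap g (remove a (b ∷ L))
  ∎
  where open ≡-Reasoning

length-remove : ∀ {a} L → Unique L → a ∈ L → suc (length (remove a L)) ≡ length L
length-remove {a} (b ∷ L) (b∉L ∷ L!) a∈ with b ≟ a | a∈
... | yes refl | _         = cong (suc ∘ length) (remove-∷-self b L (λ b∈L → All.lookup b∉L b∈L refl))
... | no b≢a   | here a≡b  = ⊥-elim (b≢a (sym a≡b))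
... | no b≢a   | there a∈L = trans (cong (suc ∘ length) (remove-∷-other a b L b≢a)) (cong suc (length-remove L L! a∈L))

sumMap-𝟙-∈ : ∀ R L → Unique R → Unique L → (∀ {z} → z ∈ L → z ∈ R) → ∀ (g : ℕ → ℚ) →
             sumMap (λ s → 𝟙 (s ∈? L) * g s) R ≡ sumMap g L
sumMap-𝟙-∈ [] [] _ _ _ g = refl
sumMap-𝟙-∈ [] (z ∷ L) _ _ L⊆R g with L⊆R (here refl)
... | ()
sumMap-𝟙-∈ (a ∷ R) L (a∉R ∷ R!) L! L⊆R g with a ∈? L
... | yes a∈L = begin
    1ℚ * g a + sumMap (λ s → 𝟙 (s ∈? L) * g s) R
  ≡⟨ cong₂ _+_ (ℚP.*-identityˡ (g a)) (sumMap-cong R (λ s s∈R → cong (_* g s)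
       (𝟙-⇔ (λ s∈L → ∈-remove⁺ s∈L (λ s≡a → All.lookup a∉R s∈R (sym s≡a))) (proj₁ ∘ ∈-remove⁻) (s ∈? L) (s ∈? remove a L)))) ⟩
    g a + sumMap (λ s → 𝟙 (s ∈? remove a L) * g s) R
  ≡⟨ cong (λ z → g a + z) (sumMap-𝟙-∈ R (remove a L) R! (Unique.filter⁺ _ L!) L∖a⊆R g) ⟩
    g a + sumMap g (remove a L)
  ≡⟨ sym (sumMap-remove g L L! a∈L) ⟩
    sumMap g L
  ∎
  where
  open ≡-Reasoning
  L∖a⊆R : ∀ {z} → z ∈ remove a L → z ∈ R
  L∖a⊆R z∈ with ∈-remove⁻ z∈
  ... | z∈L , z≢a with L⊆R z∈L
  ...   | here z≡a   = ⊥-elim (z≢a z≡a)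
  ...   | there z∈R = z∈R
... | no a∉L = trans (cong (_+ sumMap (λ s → 𝟙 (s ∈? L) * g s) R) (ℚP.*-zeroˡ (g a)))
                     (trans (ℚP.+-identityˡ _) (sumMap-𝟙-∈ R L R! L! L⊆R′ g))
  where
  L⊆R′ : ∀ {z} → z ∈ L → z ∈ R
  L⊆R′ z∈L with L⊆R z∈L
  ... | here refl = ⊥-elim (a∉L z∈L)
  ... | there z∈R = z∈R

rank : List ℕ → ℕ → ℕ
rank L r = length (filter (_<? r) L)

corank : List ℕ → ℕ → ℕ
corank L r = length (filter (r <?_) L)

rank-∷-< : ∀ {a r} L → a < r → rank (a ∷ L) r ≡ suc (rank L r)
rank-∷-< {r = r} L a<r = cong length (List.filter-accept (_<? r) a<r)

rank-∷-≮ : ∀ {a r} L → ¬ a < r → rank (a ∷ L) r ≡ rank L r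
rank-∷-≮ {r = r} L a≮r = cong length (List.filter-reject (_<? r) a≮r)

rank-≡0 : ∀ {r} L → All (λ z → ¬ z < r) L → rank L r ≡ 0
rank-≡0 {r} L none = cong length (List.filter-none (_<? r) none)

rank-head : ∀ {a L} → All (a <_) L → rank (a ∷ L) a ≡ 0
rank-head {a} {L} a<L = rank-≡0 (a ∷ L) (ℕP.<-irrefl refl ∷ All.map ℕP.<-asym a<L)

corank-∷-< : ∀ {a r} L → r < a → corank (a ∷ L) r ≡ suc (corank L r)
corank-∷-< {r = r} L r<a = cong length (List.filter-accept (r <?_) r<a)

corank-∷-≮ : ∀ {a r} L → ¬ r < a → corank (a ∷ L) r ≡ corank L r
corank-∷-≮ {r = r} L r≮a = cong length (List.filter-reject (r <?_) r≮a)

sumMap-rank : ∀ {L} → AllPairs _<_ L → ∀ G → sumMap (G ∘ rank L) L ≡ Σ (length L) G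
sumMap-rank [] G = refl
sumMap-rank {a ∷ L} (a<L ∷ L↑) G = begin
    G (rank (a ∷ L) a) + sumMap (G ∘ rank (a ∷ L)) L
  ≡⟨ cong₂ _+_ (cong G (rank-head a<L)) (sumMap-cong L (λ r r∈L → cong G (rank-∷-< L (All.lookup a<L r∈L)))) ⟩
    G 0 + sumMap (λ r → G (suc (rank L r))) L
  ≡⟨ cong (λ z → G 0 + z) (sumMap-rank L↑ (G ∘ suc)) ⟩
    G 0 + Σ (length L) (G ∘ suc)
  ≡⟨ sym (Σ-sucˡ (length L) G) ⟩
    Σ (suc (length L)) G
  ∎
  where open ≡-Reasoning

rank+corank : ∀ {L} → AllPairs _<_ L → ∀ {r} → r ∈ L → suc (rank L r ℕ.+ corank L r) ≡ length L
rank+corank {a ∷ L} (a<L ∷ L↑) (here refl) =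
  cong suc (cong₂ ℕ._+_ (rank-head a<L) (trans (corank-∷-≮ L (ℕP.<-irrefl refl)) (cong length (List.filter-all (a <?_) a<L))))
rank+corank {a ∷ L} (a<L ∷ L↑) {r} (there r∈L) =
  trans (cong suc (cong₂ ℕ._+_ (rank-∷-< L a<r) (corank-∷-≮ L (ℕP.<-asym a<r)))) (cong suc (rank+corank L↑ r∈L))
  where a<r = All.lookup a<L r∈L

corank≡length∸rank : ∀ {L} → AllPairs _<_ L → ∀ {r} → r ∈ L → corank L r ≡ length L ℕ.∸ suc (rank L r)
corank≡length∸rank {L} L↑ {r} r∈L =
  sym (trans (cong (ℕ._∸ suc (rank L r)) (sym (rank+corank L↑ r∈L))) (ℕP.m+n∸m≡n (rank L r) (corank L r)))

<ᵇ-rank : ∀ {L} → AllPairs _<_ L → ∀ {r₀ r} → r₀ ∉ L → r ∈ L → (r₀ <ᵇ r) ≡ (rank L r₀ ≤ᵇ rank L r)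
<ᵇ-rank {a ∷ L} (a<L ∷ L↑) {r₀} {r} r₀∉ r∈ with ℕP.<-cmp a r₀
... | tri≈ _ a≡r₀ _ = ⊥-elim (r₀∉ (here (sym a≡r₀)))
<ᵇ-rank {a ∷ L} (a<L ∷ L↑) {r₀} {r} r₀∉ (here refl) | tri< a<r₀ _ _ =
  trans (dec-false (r₀ <? a) (ℕP.<-asym a<r₀)) (sym (cong₂ _≤ᵇ_ (rank-∷-< L a<r₀) (rank-head a<L)))
<ᵇ-rank {a ∷ L} (a<L ∷ L↑) {r₀} {r} r₀∉ (there r∈L) | tri< a<r₀ _ _ =
  trans (<ᵇ-rank L↑ (r₀∉ ∘ there) r∈L)
        (sym (trans (cong₂ _≤ᵇ_ (rank-∷-< L a<r₀) (rank-∷-< L (All.lookup a<L r∈L))) (≤ᵇ-suc (rank L r₀) (rank L r))))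
<ᵇ-rank {a ∷ L} (a<L ∷ L↑) {r₀} {r} r₀∉ r∈ | tri> _ _ r₀<a =
  trans (dec-true (r₀ <? r) (r₀<r r∈))
        (cong (_≤ᵇ rank (a ∷ L) r) (sym (rank-≡0 (a ∷ L) (ℕP.<-asym r₀<a ∷ All.map (λ a<z z<r₀ → ℕP.<-asym r₀<a (ℕP.<-trans a<z z<r₀)) a<L))))
  where
  r₀<r : ∀ {r} → r ∈ a ∷ L → r₀ < r
  r₀<r (here refl)  = r₀<a
  r₀<r (there r∈L) = ℕP.<-trans r₀<a (All.lookup a<L r∈L)

rank-remove : ∀ {a r} L → ¬ a < r → rank (remove a L) r ≡ rank L r
rank-remove [] a≮r = refl
rank-remove {a} {r} (b ∷ L) a≮r with b ≟ a
... | yes refl = trans (cong (λ z → rank z r) (List.filter-reject (λ z → ¬? (z ≟ b)) (λ b≢b → b≢b refl)))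
                       (trans (rank-remove L a≮r) (sym (rank-∷-≮ L a≮r)))
... | no b≢a with b <? r
...   | yes b<r = trans (cong (λ z → rank z r) (remove-∷-other a b L b≢a))
                        (trans (rank-∷-< (remove a L) b<r) (trans (cong suc (rank-remove L a≮r)) (sym (rank-∷-< L b<r))))
...   | no b≮r = trans (cong (λ z → rank z r) (remove-∷-other a b L b≢a))
                       (trans (rank-∷-≮ (remove a L) b≮r) (trans (rank-remove L a≮r) (sym (rank-∷-≮ L b≮r))))

sumMap-𝟙-< : ∀ r L → sumMap (λ s → 𝟙 (r <? s)) L ≡ fromℕ (corank L r)
sumMap-𝟙-< r [] = refl
sumMap-𝟙-< r (b ∷ L) with r <? b
... | yes r<b = trans (cong₂ _+_ (𝟙-yes r<b (r <? b)) (sumMap-𝟙-< r L))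
                      (trans (sym (fromℕ-+ 1 (corank L r))) (cong fromℕ (sym (corank-∷-< L r<b))))
... | no r≮b  = trans (cong₂ _+_ (𝟙-no r≮b (r <? b)) (sumMap-𝟙-< r L))
                      (trans (ℚP.+-identityˡ _) (cong fromℕ (sym (corank-∷-≮ L r≮b))))

fromℕ-orderedPairs : ∀ a → fromℕ a * (fromℕ a - 1ℚ) ≡ fromℕ (orderedPairs a)
fromℕ-orderedPairs zero    = refl
fromℕ-orderedPairs (suc a) = begin
    fromℕ (suc a) * (fromℕ (suc a) - 1ℚ)
  ≡⟨ cong (λ z → z * (z - 1ℚ)) (fromℕ-+ 1 a) ⟩
    (1ℚ + fromℕ a) * ((1ℚ + fromℕ a) - 1ℚ)
  ≡⟨ solve 1 (λ b → (con 1ℚ :+ b) :* ((con 1ℚ :+ b) :- con 1ℚ) := (con 1ℚ :+ b) :* b) refl (fromℕ a) ⟩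
    (1ℚ + fromℕ a) * fromℕ a
  ≡⟨ cong (_* fromℕ a) (sym (fromℕ-+ 1 a)) ⟩
    fromℕ (suc a) * fromℕ a
  ≡⟨ sym (fromℕ-* (suc a) a) ⟩
    fromℕ (orderedPairs (suc a))
  ∎
  where open ≡-Reasoning

sumMap-𝟙-<-≢ : ∀ {L r l} → Unique L → l ∈ L → r < l →
               sumMap (λ s → 𝟙 ((r <? s) ×-dec ¬? (l ≟ s))) L ≡ fromℕ (corank L r) - 1ℚ
sumMap-𝟙-<-≢ {L} {r} {l} L! l∈L r<l = begin
    sumMap f L
  ≡⟨ sumMap-remove f L L! l∈L ⟩
    f l + sumMap f (remove l L)
  ≡⟨ cong₂ _+_ (trans (𝟙-× (r <? l) (¬? (l ≟ l)))
                      (trans (cong (𝟙 (r <? l) *_) (𝟙-no (λ l≢l → l≢l refl) (¬? (l ≟ l)))) (ℚP.*-zeroʳ (𝟙 (r <? l)))))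
               (sumMap-cong (remove l L) (λ s s∈ → trans (𝟙-× (r <? s) (¬? (l ≟ s)))
                 (trans (cong (𝟙 (r <? s) *_) (𝟙-yes (≢-sym (proj₂ (∈-remove⁻ {l} {s} {L} s∈))) (¬? (l ≟ s))))
                        (ℚP.*-identityʳ (𝟙 (r <? s)))))) ⟩
    0ℚ + sumMap above (remove l L)
  ≡⟨ solve 1 (λ q → con 0ℚ :+ q := (con 1ℚ :+ q) :- con 1ℚ) refl (sumMap above (remove l L)) ⟩
    (1ℚ + sumMap above (remove l L)) - 1ℚ
  ≡⟨ cong (λ z → (z + sumMap above (remove l L)) - 1ℚ) (sym (𝟙-yes r<l (r <? l))) ⟩
    (above l + sumMap above (remove l L)) - 1ℚ
  ≡⟨ cong (_- 1ℚ) (trans (sym (sumMap-remove above L L! l∈L)) (sumMap-𝟙-< r L)) ⟩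
    fromℕ (corank L r) - 1ℚ
  ∎
  where
  open ≡-Reasoning
  f above : ℕ → ℚ
  f s = 𝟙 ((r <? s) ×-dec ¬? (l ≟ s))
  above s = 𝟙 (r <? s)

sumMap-triples : ∀ M (f : Shrub → ℚ) →
  sumMap f (triples M) ≡ sumMap (λ r → sumMap (λ l → sumMap (λ s → f (r , l , s)) (range1 M)) (range1 M)) (range1 M)
sumMap-triples M f = trans (sumMap-concatMap f _ (range1 M))
  (sumMap-cong (range1 M) (λ r _ → trans (sumMap-concatMap f _ (range1 M)) (sumMap-cong (range1 M) (λ l _ → sumMap-map f _ (range1 M)))))

range1≡applyUpTo : ∀ m → range1 m ≡ List.applyUpTo suc m
range1≡applyUpTo m = List.map-applyUpTo (λ i → i) suc m

range1-sorted : ∀ m → AllPairs _<_ (range1 m)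
range1-sorted m = subst (AllPairs _<_) (sym (range1≡applyUpTo m)) (AllPairs.applyUpTo⁺₁ suc m (λ i<j _ → s≤s i<j))

range1-unique : ∀ m → Unique (range1 m)
range1-unique m = AllPairs.map ℕP.<⇒≢ (range1-sorted m)

length-range1 : ∀ m → length (range1 m) ≡ m
length-range1 m = trans (cong length (range1≡applyUpTo m)) (List.length-applyUpTo suc m)

∈-range1⁻ : ∀ {m z} → z ∈ range1 m → InRange m z
∈-range1⁻ {m} z∈ with ∈-applyUpTo⁻ suc (subst (_ ∈_) (range1≡applyUpTo m) z∈)
... | i , i<m , refl = s≤s z≤n , i<m

∈-range1⁺ : ∀ {m z} → InRange m z → z ∈ range1 m
∈-range1⁺ {m} {suc i} (_ , i<m) = subst (_ ∈_) (sym (range1≡applyUpTo m)) (∈-applyUpTo⁺ suc i<m)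

IsForestOn : List ℕ → ∀ {k} → Vec Shrub k → Set
IsForestOn L F = All ValidShrub (toList F) × Unique (labels F) × All (_∈ L) (labels F) × All (_∈ labels F) L

isForestOn? : (L : List ℕ) → ∀ {k} (F : Vec Shrub k) → Dec (IsForestOn L F)
isForestOn? L F = all? validShrub? (toList F) ×-dec unique? (labels F) ×-dec all? (_∈? L) (labels F) ×-dec all? (_∈? labels F) L

IsShrubOn : List ℕ → Shrub → Set
IsShrubOn L (r , l , s) = r ∈ L × (l ∈ L × r < l) × (s ∈ L × (r < s × l ≢ s))

isShrubOn? : (L : List ℕ) (t : Shrub) → Dec (IsShrubOn L t)
isShrubOn? L (r , l , s) = (r ∈? L) ×-dec (((l ∈? L) ×-dec (r <? l)) ×-dec ((s ∈? L) ×-dec ((r <? s) ×-dec ¬? (l ≟ s))))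

sumMap-isShrubOn : ∀ {R L} → Unique R → Unique L → (∀ {z} → z ∈ L → z ∈ R) → ∀ r →
  sumMap (λ l → sumMap (λ s → 𝟙 (isShrubOn? L (r , l , s))) R) R ≡ 𝟙 (r ∈? L) * fromℕ (orderedPairs (corank L r))
sumMap-isShrubOn {R} {L} R! L! L⊆R r = begin
    sumMap (λ l → sumMap (λ s → 𝟙 (isShrubOn? L (r , l , s))) R) R
  ≡⟨ sumMap-cong R (λ l _ → trans (sumMap-cong R (λ s _ → factor l s))
                                   (sym (sumMap-*ˡ (K * 𝟙 (left? l)) (λ s → 𝟙 (s ∈? L) * 𝟙 (right? l s)) R))) ⟩
    sumMap (λ l → (K * 𝟙 (left? l)) * sumMap (λ s → 𝟙 (s ∈? L) * 𝟙 (right? l s)) R) R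
  ≡⟨ sumMap-cong R (λ l _ → trans (cong ((K * 𝟙 (left? l)) *_) (sumMap-𝟙-∈ R L R! L! L⊆R (λ s → 𝟙 (right? l s))))
       (trans (cong (λ z → (K * z) * rights l) (𝟙-× (l ∈? L) (r <? l)))
              (solve 4 (λ k a b c → (k :* (a :* b)) :* c := a :* (k :* (b :* c))) refl K (𝟙 (l ∈? L)) (𝟙 (r <? l)) (rights l)))) ⟩
    sumMap (λ l → 𝟙 (l ∈? L) * (K * (𝟙 (r <? l) * rights l))) R
  ≡⟨ sumMap-𝟙-∈ R L R! L! L⊆R (λ l → K * (𝟙 (r <? l) * rights l)) ⟩
    sumMap (λ l → K * (𝟙 (r <? l) * rights l)) L
  ≡⟨ sumMap-cong L (λ l l∈L → cong (K *_) (children l l∈L (r <? l))) ⟩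
    sumMap (λ l → K * (𝟙 (r <? l) * (fromℕ (corank L r) - 1ℚ))) L
  ≡⟨ sym (sumMap-*ˡ K _ L) ⟩
    K * sumMap (λ l → 𝟙 (r <? l) * (fromℕ (corank L r) - 1ℚ)) L
  ≡⟨ cong (K *_) (trans (sym (sumMap-*ʳ (fromℕ (corank L r) - 1ℚ) (λ l → 𝟙 (r <? l)) L))
                        (cong (_* (fromℕ (corank L r) - 1ℚ)) (sumMap-𝟙-< r L))) ⟩
    K * (fromℕ (corank L r) * (fromℕ (corank L r) - 1ℚ))
  ≡⟨ cong (K *_) (fromℕ-orderedPairs (corank L r)) ⟩
    K * fromℕ (orderedPairs (corank L r))
  ∎
  where
  open ≡-Reasoning
  K = 𝟙 (r ∈? L)
  left? : ∀ l → Dec (l ∈ L × r < l)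
  left? l = (l ∈? L) ×-dec (r <? l)
  right? : ∀ l s → Dec (r < s × l ≢ s)
  right? l s = (r <? s) ×-dec ¬? (l ≟ s)
  rights : ℕ → ℚ
  rights l = sumMap (λ s → 𝟙 (right? l s)) L
  factor : ∀ l s → 𝟙 (isShrubOn? L (r , l , s)) ≡ (K * 𝟙 (left? l)) * (𝟙 (s ∈? L) * 𝟙 (right? l s))
  factor l s = trans (𝟙-× (r ∈? L) (left? l ×-dec ((s ∈? L) ×-dec right? l s)))
    (trans (cong (K *_) (trans (𝟙-× (left? l) ((s ∈? L) ×-dec right? l s)) (cong (𝟙 (left? l) *_) (𝟙-× (s ∈? L) (right? l s)))))
           (sym (ℚP.*-assoc K (𝟙 (left? l)) _)))
  children : ∀ l → l ∈ L → (r<l? : Dec (r < l)) → 𝟙 r<l? * rights l ≡ 𝟙 r<l? * (fromℕ (corank L r) - 1ℚ)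
  children l l∈L (yes r<l) = cong (1ℚ *_) (sumMap-𝟙-<-≢ L! l∈L r<l)
  children l l∈L (no _)    = trans (ℚP.*-zeroˡ (rights l)) (sym (ℚP.*-zeroˡ (fromℕ (corank L r) - 1ℚ)))

removeShrub : Shrub → List ℕ → List ℕ
removeShrub (r , l , s) L = remove s (remove l (remove r L))

∈-removeShrub⁻ : ∀ {r l s z L} → z ∈ removeShrub (r , l , s) L → z ∈ L × z ≢ r × z ≢ l × z ≢ s
∈-removeShrub⁻ z∈ with ∈-remove⁻ z∈
... | z∈₁ , z≢s with ∈-remove⁻ z∈₁
...   | z∈₂ , z≢l with ∈-remove⁻ z∈₂
...     | z∈L , z≢r = z∈L , z≢r , z≢l , z≢s

∈-removeShrub⁺ : ∀ {r l s z L} → z ∈ L → z ≢ r → z ≢ l → z ≢ s → z ∈ removeShrub (r , l , s) L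
∈-removeShrub⁺ z∈L z≢r z≢l z≢s = ∈-remove⁺ (∈-remove⁺ (∈-remove⁺ z∈L z≢r) z≢l) z≢s

isForestOn-∷⁻ : ∀ L r l s {k} (F : Vec Shrub k) → IsForestOn L ((r , l , s) ∷ F) →
                IsShrubOn L (r , l , s) × IsForestOn (removeShrub (r , l , s) L) F
isForestOn-∷⁻ L r l s F (valid ∷ F-valid , (r∉ ∷ l∉ ∷ s∉ ∷ F!) , (r∈ ∷ l∈ ∷ s∈ ∷ F⊆L) , L⊆) =
  (r∈ , (l∈ , proj₁ valid) , (s∈ , (proj₂ valid , All.head l∉))) ,
  (F-valid , F! , All.tabulate labels⊆ , All.tabulate covered)
  where
  labels⊆ : ∀ {z} → z ∈ labels F → z ∈ removeShrub (r , l , s) L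
  labels⊆ z∈ = ∈-removeShrub⁺ (All.lookup F⊆L z∈) (≢-sym (All.lookup (All.tail (All.tail r∉)) z∈))
                 (≢-sym (All.lookup (All.tail l∉) z∈)) (≢-sym (All.lookup s∉ z∈))
  covered : ∀ {z} → z ∈ removeShrub (r , l , s) L → z ∈ labels F
  covered z∈ with ∈-removeShrub⁻ z∈
  ... | z∈L , z≢r , z≢l , z≢s with All.lookup L⊆ z∈L
  ...   | here z≡r                 = ⊥-elim (z≢r z≡r)
  ...   | there (here z≡l)         = ⊥-elim (z≢l z≡l)
  ...   | there (there (here z≡s)) = ⊥-elim (z≢s z≡s)
  ...   | there (there (there z∈)) = z∈

isForestOn-∷⁺ : ∀ L r l s {k} (F : Vec Shrub k) → IsShrubOn L (r , l , s) → IsForestOn (removeShrub (r , l , s) L) F →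
                IsForestOn L ((r , l , s) ∷ F)
isForestOn-∷⁺ L r l s F (r∈ , (l∈ , r<l) , (s∈ , (r<s , l≢s))) (F-valid , F! , F⊆ , covered) =
  ((r<l , r<s) ∷ F-valid) ,
  ((ℕP.<⇒≢ r<l ∷ ℕP.<⇒≢ r<s ∷ All.map (λ z∈ → ≢-sym (proj₁ (proj₂ (fresh z∈)))) F⊆)
    ∷ (l≢s ∷ All.map (λ z∈ → ≢-sym (proj₁ (proj₂ (proj₂ (fresh z∈))))) F⊆)
    ∷ All.map (λ z∈ → ≢-sym (proj₂ (proj₂ (proj₂ (fresh z∈))))) F⊆
    ∷ F!) ,
  (r∈ ∷ l∈ ∷ s∈ ∷ All.map (proj₁ ∘ fresh) F⊆) ,
  All.tabulate labelled
  where
  fresh : ∀ {z} → z ∈ removeShrub (r , l , s) L → z ∈ L × z ≢ r × z ≢ l × z ≢ s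
  fresh = ∈-removeShrub⁻ {r} {l} {s} {L = L}
  labelled : ∀ {z} → z ∈ L → z ∈ r ∷ l ∷ s ∷ labels F
  labelled {z} z∈L with z ≟ r | z ≟ l | z ≟ s
  ... | yes z≡r | _       | _       = here z≡r
  ... | no _    | yes z≡l | _       = there (here z≡l)
  ... | no _    | no _    | yes z≡s = there (there (here z≡s))
  ... | no z≢r  | no z≢l  | no z≢s  = there (there (there (All.lookup covered (∈-removeShrub⁺ z∈L z≢r z≢l z≢s))))

𝟙-isForestOn-∷ : ∀ L r l s {k} (F : Vec Shrub k) →
  𝟙 (isForestOn? L ((r , l , s) ∷ F)) ≡ 𝟙 (isShrubOn? L (r , l , s)) * 𝟙 (isForestOn? (removeShrub (r , l , s) L) F)
𝟙-isForestOn-∷ L r l s F = split (isShrubOn? L (r , l , s))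
  where
  rest? = isForestOn? (removeShrub (r , l , s) L) F
  split : (shrub? : Dec (IsShrubOn L (r , l , s))) → 𝟙 (isForestOn? L ((r , l , s) ∷ F)) ≡ 𝟙 shrub? * 𝟙 rest?
  split (yes shrub) = trans (𝟙-⇔ (proj₂ ∘ isForestOn-∷⁻ L r l s F) (isForestOn-∷⁺ L r l s F shrub) (isForestOn? L _) rest?)
                            (sym (ℚP.*-identityˡ (𝟙 rest?)))
  split (no ¬shrub) = trans (𝟙-no (¬shrub ∘ proj₁ ∘ isForestOn-∷⁻ L r l s F) (isForestOn? L _)) (sym (ℚP.*-zeroˡ (𝟙 rest?)))

removeShrub-sorted : ∀ t {L} → AllPairs _<_ L → AllPairs _<_ (removeShrub t L)
removeShrub-sorted (r , l , s) L↑ = AllPairs.filter⁺ _ (AllPairs.filter⁺ _ (AllPairs.filter⁺ _ L↑))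

length-removeShrub : ∀ {L r l s} → Unique L → IsShrubOn L (r , l , s) → 3 ℕ.+ length (removeShrub (r , l , s) L) ≡ length L
length-removeShrub {L} {r} {l} {s} L! (r∈ , (l∈ , r<l) , (s∈ , (r<s , l≢s))) = begin
    3 ℕ.+ length (removeShrub (r , l , s) L)
  ≡⟨ cong (2 ℕ.+_) (length-remove (remove l (remove r L)) (Unique.filter⁺ _ (Unique.filter⁺ _ L!))
                                  (∈-remove⁺ (∈-remove⁺ s∈ (ℕP.<⇒≢ r<s ∘ sym)) (≢-sym l≢s))) ⟩
    2 ℕ.+ length (remove l (remove r L))
  ≡⟨ cong suc (length-remove (remove r L) (Unique.filter⁺ _ L!) (∈-remove⁺ l∈ (ℕP.<⇒≢ r<l ∘ sym))) ⟩
    suc (length (remove r L))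
  ≡⟨ length-remove L L! r∈ ⟩
    length L
  ∎
  where open ≡-Reasoning

rank-removeShrub : ∀ {L r l s} → IsShrubOn L (r , l , s) → rank (removeShrub (r , l , s) L) r ≡ rank L r
rank-removeShrub {L} {r} {l} (_ , (_ , r<l) , (_ , (r<s , _))) =
  trans (rank-remove (remove l (remove r L)) (ℕP.<-asym r<s))
        (trans (rank-remove (remove r L) (ℕP.<-asym r<l)) (rank-remove L (ℕP.<-irrefl refl)))

data Mod3 : ℕ → Set where
  mod0 : ∀ q → Mod3 (3 ℕ.* q)
  mod1 : ∀ q → Mod3 (suc (3 ℕ.* q))
  mod2 : ∀ q → Mod3 (suc (suc (3 ℕ.* q)))

mod3 : ∀ m → Mod3 m
mod3 zero = mod0 0
mod3 (suc m) with mod3 m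
... | mod0 q = mod1 q
... | mod1 q = mod2 q
... | mod2 q = subst Mod3 (ℕP.*-suc 3 q) (mod0 (suc q))

[r+3q]%3≡r : ∀ r q → r < 3 → (r ℕ.+ 3 ℕ.* q) ℕ.% 3 ≡ r
[r+3q]%3≡r r q r<3 = trans (cong (λ n → (r ℕ.+ n) ℕ.% 3) (ℕP.*-comm 3 q)) (trans (DM.[m+kn]%n≡m%n r q 3) (DM.m<n⇒m%n≡m r<3))

3q/3≡q : ∀ q → (3 ℕ.* q) ℕ./ 3 ≡ q
3q/3≡q q = trans (cong (ℕ._/ 3) (ℕP.*-comm 3 q)) (DM.m*n/n≡m q 3)

3n≤r+3q⇒n≤q : ∀ {r n q} → r < 3 → 3 ℕ.* n ≤ r ℕ.+ 3 ℕ.* q → n ≤ q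
3n≤r+3q⇒n≤q {r} {n} {q} r<3 3n≤ =
  ℕP.≤-pred (ℕP.*-cancelˡ-< 3 n (suc q) (ℕP.≤-<-trans 3n≤ (subst (r ℕ.+ 3 ℕ.* q <_) (sym (ℕP.*-suc 3 q)) (ℕP.+-monoˡ-< (3 ℕ.* q) r<3))))

record Lacunary (a : ℕ → ℚ) : Set where
  field
    at-3q+1 : ∀ q → a (suc (3 ℕ.* q)) ≡ 0ℚ
    at-3q+2 : ∀ q → a (suc (suc (3 ℕ.* q))) ≡ 0ℚ
open Lacunary

cauchy-Σ : ∀ a b m → cauchy a b m ≡ Σ (suc m) (λ k → a k * b (m ℕ.∸ k))
cauchy-Σ a b m = sumℚ-map-applyUpTo (suc m) (λ k → a k * b (m ℕ.∸ k)) (λ k → k)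

module _ {a : ℕ → ℚ} (a-lacunary : Lacunary a) where

  cauchy-3* : ∀ b q → cauchy a b (3 ℕ.* q) ≡ Σ (suc q) (λ n → a (3 ℕ.* n) * b (3 ℕ.* (q ℕ.∸ n)))
  cauchy-3* b q = begin
      cauchy a b (3 ℕ.* q)
    ≡⟨ cauchy-Σ a b (3 ℕ.* q) ⟩
      Σ (3 ℕ.* q) f + f (3 ℕ.* q)
    ≡⟨ cong (_+ f (3 ℕ.* q)) (Σ-lacunary q f (vanish ∘ at-3q+1 a-lacunary) (vanish ∘ at-3q+2 a-lacunary)) ⟩
      Σ (suc q) (λ n → f (3 ℕ.* n))
    ≡⟨ Σ-cong (suc q) (λ n _ → cong (λ k → a (3 ℕ.* n) * b k) (sym (ℕP.*-distribˡ-∸ 3 q n))) ⟩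
      Σ (suc q) (λ n → a (3 ℕ.* n) * b (3 ℕ.* (q ℕ.∸ n)))
    ∎
    where
    open ≡-Reasoning
    f : ℕ → ℚ
    f k = a k * b (3 ℕ.* q ℕ.∸ k)
    vanish : ∀ {k} → a k ≡ 0ℚ → f k ≡ 0ℚ
    vanish {k} ak≡0 = trans (cong (_* b (3 ℕ.* q ℕ.∸ k)) ak≡0) (ℚP.*-zeroˡ (b (3 ℕ.* q ℕ.∸ k)))

  cauchy-lacunary : ∀ {b} → Lacunary b → Lacunary (cauchy a b)
  cauchy-lacunary {b} b-lacunary = record
    { at-3q+1 = vanishes 1 (at-3q+1 b-lacunary) (s≤s (s≤s z≤n))
    ; at-3q+2 = vanishes 2 (at-3q+2 b-lacunary) (s≤s (s≤s (s≤s z≤n)))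
    }
    where
    vanishes : ∀ r → (∀ p → b (r ℕ.+ 3 ℕ.* p) ≡ 0ℚ) → r < 3 → ∀ q → cauchy a b (r ℕ.+ 3 ℕ.* q) ≡ 0ℚ
    vanishes r b-vanishes r<3 q =
      trans (cauchy-Σ a b (r ℕ.+ 3 ℕ.* q)) (Σ-zero (suc (r ℕ.+ 3 ℕ.* q)) (λ k k≤ → term k (ℕP.≤-pred k≤) (mod3 k)))
      where
      term : ∀ k → k ≤ r ℕ.+ 3 ℕ.* q → Mod3 k → a k * b (r ℕ.+ 3 ℕ.* q ℕ.∸ k) ≡ 0ℚ
      term _ 3n≤ (mod0 n) = trans (cong (λ i → a (3 ℕ.* n) * b i) r+3q-3n)
                                  (trans (cong (a (3 ℕ.* n) *_) (b-vanishes (q ℕ.∸ n))) (ℚP.*-zeroʳ (a (3 ℕ.* n))))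
        where
        r+3q-3n : r ℕ.+ 3 ℕ.* q ℕ.∸ 3 ℕ.* n ≡ r ℕ.+ 3 ℕ.* (q ℕ.∸ n)
        r+3q-3n = trans (ℕP.+-∸-assoc r (ℕP.*-monoʳ-≤ 3 (3n≤r+3q⇒n≤q {r} {n} {q} r<3 3n≤))) (cong (r ℕ.+_) (sym (ℕP.*-distribˡ-∸ 3 q n)))
      term k _ (mod1 n) = trans (cong (_* b (r ℕ.+ 3 ℕ.* q ℕ.∸ k)) (at-3q+1 a-lacunary n)) (ℚP.*-zeroˡ (b (r ℕ.+ 3 ℕ.* q ℕ.∸ k)))
      term k _ (mod2 n) = trans (cong (_* b (r ℕ.+ 3 ℕ.* q ℕ.∸ k)) (at-3q+2 a-lacunary n)) (ℚP.*-zeroˡ (b (r ℕ.+ 3 ℕ.* q ℕ.∸ k)))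

-- The rise polynomials

module _ (x : ℚ) where

  x-1 : ℚ
  x-1 = x - 1ℚ

  riseWeight : ℕ → ℕ → ℚ
  riseWeight c i = if c ≤ᵇ i then x else 1ℚ

  riseWeight-indicator : ∀ c i → riseWeight c i ≡ 1ℚ + fromℕ 𝟙[ c ≤ i ] * x-1
  riseWeight-indicator c i with c ≤ᵇ i
  ... | true  = solve 1 (λ x → x := con 1ℚ :+ con 1ℚ :* (x :- con 1ℚ)) refl x
  ... | false = solve 1 (λ x → con 1ℚ := con 1ℚ :+ con 0ℚ :* (x :- con 1ℚ)) refl x

  -- riseSum n c sums x^(number of rises among the roots) over forests of n shrubs on 3n labels that
  -- are preceded by a root having c of the labels below it; a first root of rank i leaves
  -- 2 + 3n - i labels above it for its two children.
  riseSum : ℕ → ℕ → ℚ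
  riseSum zero    c = 1ℚ
  riseSum (suc n) c = Σ (3 ℕ.+ 3 ℕ.* n) (λ i → riseWeight c i * (fromℕ (orderedPairs (2 ℕ.+ 3 ℕ.* n ℕ.∸ i)) * riseSum n i))

  rootTerm : ℕ → ℕ → ℚ
  rootTerm n i = fromℕ (orderedPairs (2 ℕ.+ 3 ℕ.* n ℕ.∸ i)) * riseSum n i

  forestSum : ℕ → ℚ
  forestSum n = riseSum n (3 ℕ.* n)

  riseSum-split : ∀ n c → riseSum (suc n) c ≡
    Σ (3 ℕ.+ 3 ℕ.* n) (rootTerm n) + x-1 * Σ (3 ℕ.+ 3 ℕ.* n) (λ i → fromℕ 𝟙[ c ≤ i ] * rootTerm n i)
  riseSum-split n c = begin
      riseSum (suc n) c
    ≡⟨ Σ-cong (3 ℕ.+ 3 ℕ.* n) (λ i _ → split i) ⟩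
      Σ (3 ℕ.+ 3 ℕ.* n) (λ i → rootTerm n i + x-1 * (fromℕ 𝟙[ c ≤ i ] * rootTerm n i))
    ≡⟨ Σ-+ (3 ℕ.+ 3 ℕ.* n) _ _ ⟩
      Σ (3 ℕ.+ 3 ℕ.* n) (rootTerm n) + Σ (3 ℕ.+ 3 ℕ.* n) (λ i → x-1 * (fromℕ 𝟙[ c ≤ i ] * rootTerm n i))
    ≡⟨ cong (λ z → Σ (3 ℕ.+ 3 ℕ.* n) (rootTerm n) + z) (sym (Σ-*ˡ (3 ℕ.+ 3 ℕ.* n) x-1 _)) ⟩
      Σ (3 ℕ.+ 3 ℕ.* n) (rootTerm n) + x-1 * Σ (3 ℕ.+ 3 ℕ.* n) (λ i → fromℕ 𝟙[ c ≤ i ] * rootTerm n i)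
    ∎
    where
    open ≡-Reasoning
    split : ∀ i → riseWeight c i * rootTerm n i ≡ rootTerm n i + x-1 * (fromℕ 𝟙[ c ≤ i ] * rootTerm n i)
    split i = trans (cong (_* rootTerm n i) (riseWeight-indicator c i))
      (solve 3 (λ d y t → (con 1ℚ :+ d :* y) :* t := t :+ y :* (d :* t)) refl (fromℕ 𝟙[ c ≤ i ]) x-1 (rootTerm n i))

  forestSum-suc : ∀ n → forestSum (suc n) ≡ Σ (3 ℕ.+ 3 ℕ.* n) (rootTerm n)
  forestSum-suc n = begin
      riseSum (suc n) (3 ℕ.* suc n)
    ≡⟨ cong (riseSum (suc n)) (ℕP.*-suc 3 n) ⟩
      riseSum (suc n) (3 ℕ.+ 3 ℕ.* n)
    ≡⟨ riseSum-split n (3 ℕ.+ 3 ℕ.* n) ⟩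
      Σ (3 ℕ.+ 3 ℕ.* n) (rootTerm n) + x-1 * Σ (3 ℕ.+ 3 ℕ.* n) (λ i → fromℕ 𝟙[ 3 ℕ.+ 3 ℕ.* n ≤ i ] * rootTerm n i)
    ≡⟨ cong (λ z → Σ (3 ℕ.+ 3 ℕ.* n) (rootTerm n) + x-1 * z) (Σ-zero (3 ℕ.+ 3 ℕ.* n) no-rise) ⟩
      Σ (3 ℕ.+ 3 ℕ.* n) (rootTerm n) + x-1 * 0ℚ
    ≡⟨ solve 2 (λ p y → p :+ y :* con 0ℚ := p) refl (Σ (3 ℕ.+ 3 ℕ.* n) (rootTerm n)) x-1 ⟩
      Σ (3 ℕ.+ 3 ℕ.* n) (rootTerm n)
    ∎
    where
    open ≡-Reasoning
    no-rise : ∀ i → i < 3 ℕ.+ 3 ℕ.* n → fromℕ 𝟙[ 3 ℕ.+ 3 ℕ.* n ≤ i ] * rootTerm n i ≡ 0ℚ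
    no-rise i i<3n+3 rewrite dec-false (3 ℕ.+ 3 ℕ.* n ℕ.≤? i) (ℕP.<⇒≱ i<3n+3) = ℚP.*-zeroˡ (rootTerm n i)

  riseSum-suc-0 : ∀ n → riseSum (suc n) 0 ≡ x * forestSum (suc n)
  riseSum-suc-0 n = trans (sym (Σ-*ˡ (3 ℕ.+ 3 ℕ.* n) x (rootTerm n))) (cong (x *_) (sym (forestSum-suc n)))

  weight : ∀ {k} → ℕ → Vec Shrub k → ℚ
  weight r₀ F = x ^ℚ rises (r₀ ∷ map root (toList F))

  rise : ℕ → ℕ → ℚ
  rise r₀ r = if r₀ <ᵇ r then x else 1ℚ

  weight-∷ : ∀ {k} r₀ r l s (F : Vec Shrub k) → weight r₀ ((r , l , s) ∷ F) ≡ rise r₀ r * weight r F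
  weight-∷ r₀ r l s F =
    trans (^ℚ-+ x (if r₀ <ᵇ r then 1 else 0) (rises (r ∷ map root (toList F)))) (cong (_* weight r F) (step (r₀ <ᵇ r)))
    where
    step : ∀ b → x ^ℚ (if b then 1 else 0) ≡ (if b then x else 1ℚ)
    step true  = ℚP.*-identityʳ x
    step false = refl

  forestRiseSum : ℕ → List ℕ → ℕ → ℕ → ℚ
  forestRiseSum M L k r₀ = sumMap (λ F → 𝟙 (isForestOn? L F) * weight r₀ F) (vecsOver (triples M) k)

  forestRiseSum-suc : ∀ M L k r₀ → forestRiseSum M L (suc k) r₀ ≡
    sumMap (λ t → 𝟙 (isShrubOn? L t) * (rise r₀ (root t) * forestRiseSum M (removeShrub t L) k (root t))) (triples M)
  forestRiseSum-suc M L k r₀ = trans (sumMap-concatMap g (λ t → map (t ∷_) V) (triples M))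
    (sumMap-cong (triples M) (λ { (r , l , s) _ → trans (sumMap-map g ((r , l , s) ∷_) V) (first-shrub r l s) }))
    where
    V = vecsOver (triples M) k
    g : Vec Shrub (suc k) → ℚ
    g F = 𝟙 (isForestOn? L F) * weight r₀ F
    first-shrub : ∀ r l s → sumMap (λ F → g ((r , l , s) ∷ F)) V ≡
      𝟙 (isShrubOn? L (r , l , s)) * (rise r₀ r * forestRiseSum M (removeShrub (r , l , s) L) k r)
    first-shrub r l s = begin
        sumMap (λ F → g ((r , l , s) ∷ F)) V
      ≡⟨ sumMap-cong V (λ F _ → factor F) ⟩
        sumMap (λ F → (𝟙 shrub? * rise r₀ r) * (𝟙 (isForestOn? L′ F) * weight r F)) V
      ≡⟨ sym (sumMap-*ˡ (𝟙 shrub? * rise r₀ r) (λ F → 𝟙 (isForestOn? L′ F) * weight r F) V) ⟩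
        (𝟙 shrub? * rise r₀ r) * forestRiseSum M L′ k r
      ≡⟨ ℚP.*-assoc (𝟙 shrub?) (rise r₀ r) (forestRiseSum M L′ k r) ⟩
        𝟙 shrub? * (rise r₀ r * forestRiseSum M L′ k r)
      ∎
      where
      open ≡-Reasoning
      shrub? = isShrubOn? L (r , l , s)
      L′ = removeShrub (r , l , s) L
      factor : ∀ F → g ((r , l , s) ∷ F) ≡ (𝟙 shrub? * rise r₀ r) * (𝟙 (isForestOn? L′ F) * weight r F)
      factor F = trans (cong₂ _*_ (𝟙-isForestOn-∷ L r l s F) (weight-∷ r₀ r l s F))
        (solve 4 (λ a b c d → (a :* b) :* (c :* d) := (a :* c) :* (b :* d)) refl (𝟙 shrub?) (𝟙 (isForestOn? L′ F)) (rise r₀ r) (weight r F))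

  -- Removing the first shrub (r , l , s) leaves the rank of r unchanged, as l and s lie above r;
  -- its children are any ordered pair of the labels above r.  Hence the sum depends on L and r₀
  -- only through the rank of r₀, and satisfies the recursion defining riseSum.
  forestRiseSum≡riseSum : ∀ M k L r₀ → AllPairs _<_ L → (∀ {z} → z ∈ L → z ∈ range1 M) → length L ≡ 3 ℕ.* k → r₀ ∉ L →
                          forestRiseSum M L k r₀ ≡ riseSum k (rank L r₀)
  forestRiseSum≡riseSum M zero    []      r₀ _ _ _ _ = refl
  forestRiseSum≡riseSum M zero    (_ ∷ _) r₀ _ _ () _
  forestRiseSum≡riseSum M (suc k) L r₀ L↑ L⊆R |L| r₀∉L = begin
      forestRiseSum M L (suc k) r₀
    ≡⟨ forestRiseSum-suc M L k r₀ ⟩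
      sumMap (λ t → 𝟙 (isShrubOn? L t) * (rise r₀ (root t) * forestRiseSum M (removeShrub t L) k (root t))) (triples M)
    ≡⟨ sumMap-cong (triples M) (λ { (r , l , s) _ → rest-of-forest r l s (isShrubOn? L (r , l , s)) }) ⟩
      sumMap (λ t → 𝟙 (isShrubOn? L t) * h (root t)) (triples M)
    ≡⟨ sumMap-triples M _ ⟩
      sumMap (λ r → sumMap (λ l → sumMap (λ s → 𝟙 (isShrubOn? L (r , l , s)) * h r) R) R) R
    ≡⟨ sumMap-cong R (λ r _ → trans (sumMap-cong R (λ l _ → sym (sumMap-*ʳ (h r) (λ s → 𝟙 (isShrubOn? L (r , l , s))) R)))
                                     (sym (sumMap-*ʳ (h r) (λ l → sumMap (λ s → 𝟙 (isShrubOn? L (r , l , s))) R) R))) ⟩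
      sumMap (λ r → sumMap (λ l → sumMap (λ s → 𝟙 (isShrubOn? L (r , l , s))) R) R * h r) R
    ≡⟨ sumMap-cong R (λ r _ → trans (cong (_* h r) (sumMap-isShrubOn (range1-unique M) L! L⊆R r))
                                     (ℚP.*-assoc (𝟙 (r ∈? L)) _ (h r))) ⟩
      sumMap (λ r → 𝟙 (r ∈? L) * (fromℕ (orderedPairs (corank L r)) * h r)) R
    ≡⟨ sumMap-𝟙-∈ R L (range1-unique M) L! L⊆R _ ⟩
      sumMap (λ r → fromℕ (orderedPairs (corank L r)) * h r) L
    ≡⟨ sumMap-cong L (λ r r∈L → by-rank r r∈L) ⟩
      sumMap (G ∘ rank L) L
    ≡⟨ sumMap-rank L↑ G ⟩
      Σ (length L) G
    ≡⟨ cong (λ n → Σ n G) |L|′ ⟩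
      riseSum (suc k) (rank L r₀)
    ∎
    where
    open ≡-Reasoning
    R = range1 M
    L! : Unique L
    L! = AllPairs.map ℕP.<⇒≢ L↑
    |L|′ : length L ≡ 3 ℕ.+ 3 ℕ.* k
    |L|′ = trans |L| (ℕP.*-suc 3 k)
    h : ℕ → ℚ
    h r = rise r₀ r * riseSum k (rank L r)
    G : ℕ → ℚ
    G i = riseWeight (rank L r₀) i * rootTerm k i

    rest-of-forest : ∀ r l s (shrub? : Dec (IsShrubOn L (r , l , s))) →
      𝟙 shrub? * (rise r₀ r * forestRiseSum M (removeShrub (r , l , s) L) k r) ≡ 𝟙 shrub? * h r
    rest-of-forest r l s (no _)      = trans (ℚP.*-zeroˡ (rise r₀ r * forestRiseSum M (removeShrub (r , l , s) L) k r)) (sym (ℚP.*-zeroˡ (h r)))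
    rest-of-forest r l s (yes shrub) = cong (λ z → 1ℚ * (rise r₀ r * z)) (trans
      (forestRiseSum≡riseSum M k (removeShrub (r , l , s) L) r (removeShrub-sorted (r , l , s) L↑)
        (L⊆R ∘ proj₁ ∘ ∈-removeShrub⁻ {r} {l} {s} {L = L})
        (ℕP.+-cancelˡ-≡ 3 _ _ (trans (length-removeShrub L! shrub) |L|′))
        (λ r∈L′ → proj₁ (proj₂ (∈-removeShrub⁻ {r} {l} {s} {L = L} r∈L′)) refl))
      (cong (riseSum k) (rank-removeShrub shrub)))

    by-rank : ∀ r → r ∈ L → fromℕ (orderedPairs (corank L r)) * h r ≡ G (rank L r)
    by-rank r r∈L = begin
        fromℕ (orderedPairs (corank L r)) * (rise r₀ r * riseSum k (rank L r))
      ≡⟨ cong₂ (λ a b → fromℕ (orderedPairs a) * ((if b then x else 1ℚ) * riseSum k (rank L r)))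
               (trans (corank≡length∸rank L↑ r∈L) (cong (ℕ._∸ suc (rank L r)) |L|′)) (<ᵇ-rank L↑ r₀∉L r∈L) ⟩
        fromℕ (orderedPairs (2 ℕ.+ 3 ℕ.* k ℕ.∸ rank L r)) * (riseWeight (rank L r₀) (rank L r) * riseSum k (rank L r))
      ≡⟨ solve 3 (λ p w f → p :* (w :* f) := w :* (p :* f)) refl
           (fromℕ (orderedPairs (2 ℕ.+ 3 ℕ.* k ℕ.∸ rank L r))) (riseWeight (rank L r₀) (rank L r)) (riseSum k (rank L r)) ⟩
        G (rank L r)
      ∎

  forestPoly≡forestSum : ∀ n → forestPoly n x ≡ forestSum n
  forestPoly≡forestSum n = begin
      sumMap (λ F → x ^ℚ risB F) (filter (isForest? n) candidates)
    ≡⟨ sumMap-filter (isForest? n) (λ F → x ^ℚ risB F) candidates ⟩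
      sumMap (λ F → if does (isForest? n F) then x ^ℚ risB F else 0ℚ) candidates
    ≡⟨ sumMap-cong candidates (λ F _ → as-forest-on-range F (isForest? n F)) ⟩
      forestRiseSum (3 ℕ.* n) R n (suc (3 ℕ.* n))
    ≡⟨ forestRiseSum≡riseSum (3 ℕ.* n) n R (suc (3 ℕ.* n)) (range1-sorted (3 ℕ.* n)) (λ z∈ → z∈) (length-range1 (3 ℕ.* n))
                             (λ top∈R → ℕP.<-irrefl refl (proj₂ (∈-range1⁻ top∈R))) ⟩
      riseSum n (rank R (suc (3 ℕ.* n)))
    ≡⟨ cong (riseSum n) rank-top ⟩
      forestSum n
    ∎
    where
    open ≡-Reasoning
    R = range1 (3 ℕ.* n)
    candidates = vecsOver (triples (3 ℕ.* n)) n
    rank-top : rank R (suc (3 ℕ.* n)) ≡ 3 ℕ.* n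
    rank-top = trans (cong length (List.filter-all (_<? suc (3 ℕ.* n)) (All.tabulate (λ z∈ → s≤s (proj₂ (∈-range1⁻ z∈))))))
                     (length-range1 (3 ℕ.* n))
    forest⇒ : ∀ F → IsForest n F → IsForestOn R F
    forest⇒ F (valid , distinct , in-range , covered) = valid , distinct , All.map ∈-range1⁺ in-range , covered
    forest⇐ : ∀ F → IsForestOn R F → IsForest n F
    forest⇐ F (valid , distinct , in-R , covered) = valid , distinct , All.map ∈-range1⁻ in-R , covered
    rises-top : ∀ {k} (F : Vec Shrub k) → All (_< suc (3 ℕ.* n)) (labels F) → rises (map root (toList F)) ≡ rises (suc (3 ℕ.* n) ∷ map root (toList F))
    rises-top []                _        = refl
    rises-top ((r , l , s) ∷ F) (r< ∷ _) =
      cong (λ b → (if b then 1 else 0) ℕ.+ rises (r ∷ map root (toList F))) (sym (dec-false (suc (3 ℕ.* n) <? r) (ℕP.<-asym r<)))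
    as-forest-on-range : ∀ F (F? : Dec (IsForest n F)) → (if does F? then x ^ℚ risB F else 0ℚ) ≡ 𝟙 (isForestOn? R F) * weight (suc (3 ℕ.* n)) F
    as-forest-on-range F (yes F-forest) = trans (cong (x ^ℚ_) (rises-top F (All.map (s≤s ∘ proj₂) (proj₁ (proj₂ (proj₂ F-forest))))))
      (trans (sym (ℚP.*-identityˡ _)) (cong (_* weight (suc (3 ℕ.* n)) F) (𝟙-⇔ (forest⇒ F) (forest⇐ F) (yes F-forest) (isForestOn? R F))))
    as-forest-on-range F (no ¬F-forest) = trans (sym (ℚP.*-zeroˡ (weight (suc (3 ℕ.* n)) F)))
      (cong (_* weight (suc (3 ℕ.* n)) F) (𝟙-⇔ (forest⇒ F) (forest⇐ F) (no ¬F-forest) (isForestOn? R F)))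

  -- Split each riseWeight c i as 1 + (x - 1) 𝟙[ c ≤ i ]: the constant part gives forestSum (suc n),
  -- and the rest, expanded by induction, collapses through the recurrence of shrubCount.
  riseSum-expansion : ∀ n c →
    riseSum n c ≡ Σ (suc n) (λ j → fromℕ (shrubCount (3 ℕ.* n ℕ.∸ c) j) * (x-1 ^ℚ j * forestSum (n ℕ.∸ j)))
  riseSum-expansion zero    c = refl
  riseSum-expansion (suc n) c = begin
      riseSum (suc n) c
    ≡⟨ riseSum-split n c ⟩
      Σ M (rootTerm n) + x-1 * Σ M (λ i → fromℕ 𝟙[ c ≤ i ] * rootTerm n i)
    ≡⟨ cong₂ (λ u v → u + x-1 * v) (sym (forestSum-suc n)) rising-part ⟩
      forestSum (suc n) + x-1 * Σ (suc n) (λ j → fromℕ (shrubCount (M ℕ.∸ c) (suc j)) * Y j)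
    ≡⟨ cong (λ z → forestSum (suc n) + z) (Σ-*ˡ (suc n) x-1 _) ⟩
      forestSum (suc n) + Σ (suc n) (λ j → x-1 * (fromℕ (shrubCount (M ℕ.∸ c) (suc j)) * Y j))
    ≡⟨ cong₂ _+_ (solve 1 (λ p → p := con 1ℚ :* (con 1ℚ :* p)) refl (forestSum (suc n)))
                 (Σ-cong (suc n) (λ j _ → trans
                   (solve 4 (λ y d p q → y :* (d :* (p :* q)) := d :* ((y :* p) :* q)) refl
                      x-1 (fromℕ (shrubCount (M ℕ.∸ c) (suc j))) (x-1 ^ℚ j) (forestSum (n ℕ.∸ j)))
                   (cong (λ N → fromℕ (shrubCount (N ℕ.∸ c) (suc j)) * (x-1 ^ℚ suc j * forestSum (n ℕ.∸ j))) (sym (ℕP.*-suc 3 n))))) ⟩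
      fromℕ 1 * (1ℚ * forestSum (suc n))
        + Σ (suc n) (λ j → fromℕ (shrubCount (3 ℕ.* suc n ℕ.∸ c) (suc j)) * (x-1 ^ℚ suc j * forestSum (suc n ℕ.∸ suc j)))
    ≡⟨ sym (Σ-sucˡ (suc n) _) ⟩
      Σ (suc (suc n)) (λ j → fromℕ (shrubCount (3 ℕ.* suc n ℕ.∸ c) j) * (x-1 ^ℚ j * forestSum (suc n ℕ.∸ j)))
    ∎
    where
    open ≡-Reasoning
    M = 3 ℕ.+ 3 ℕ.* n
    Y : ℕ → ℚ
    Y j = x-1 ^ℚ j * forestSum (n ℕ.∸ j)
    inner : ∀ j → Σℕ M (λ i → 𝟙[ c ≤ i ] ℕ.* (orderedPairs (2 ℕ.+ 3 ℕ.* n ℕ.∸ i) ℕ.* shrubCount (3 ℕ.* n ℕ.∸ i) j))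
                  ≡ shrubCount (M ℕ.∸ c) (suc j)
    inner j = trans (Σℕ-cong M (λ i _ → cong (λ k → 𝟙[ c ≤ i ] ℕ.* (orderedPairs (2 ℕ.+ 3 ℕ.* n ℕ.∸ i) ℕ.* shrubCount k j))
                                            (sym (two-less i))))
                    (Σℕ-reverse-≥ M c (λ k → orderedPairs k ℕ.* shrubCount (k ℕ.∸ 2) j))
      where
      two-less : ∀ i → (2 ℕ.+ 3 ℕ.* n ℕ.∸ i) ℕ.∸ 2 ≡ 3 ℕ.* n ℕ.∸ i
      two-less i = trans (ℕP.∸-+-assoc (2 ℕ.+ 3 ℕ.* n) i 2) (cong (2 ℕ.+ 3 ℕ.* n ℕ.∸_) (ℕP.+-comm i 2))
    merge : ∀ i j → fromℕ 𝟙[ c ≤ i ] * (fromℕ (orderedPairs (2 ℕ.+ 3 ℕ.* n ℕ.∸ i)) * (fromℕ (shrubCount (3 ℕ.* n ℕ.∸ i) j) * Y j))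
                  ≡ fromℕ (𝟙[ c ≤ i ] ℕ.* (orderedPairs (2 ℕ.+ 3 ℕ.* n ℕ.∸ i) ℕ.* shrubCount (3 ℕ.* n ℕ.∸ i) j)) * Y j
    merge i j = begin
        fromℕ δ * (fromℕ p * (fromℕ d * Y j))
      ≡⟨ solve 4 (λ δ p d y → δ :* (p :* (d :* y)) := (δ :* (p :* d)) :* y) refl (fromℕ δ) (fromℕ p) (fromℕ d) (Y j) ⟩
        (fromℕ δ * (fromℕ p * fromℕ d)) * Y j
      ≡⟨ cong (λ z → (fromℕ δ * z) * Y j) (sym (fromℕ-* p d)) ⟩
        (fromℕ δ * fromℕ (p ℕ.* d)) * Y j
      ≡⟨ cong (_* Y j) (sym (fromℕ-* δ (p ℕ.* d))) ⟩
        fromℕ (δ ℕ.* (p ℕ.* d)) * Y j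
      ∎
      where
      δ = 𝟙[ c ≤ i ]
      p = orderedPairs (2 ℕ.+ 3 ℕ.* n ℕ.∸ i)
      d = shrubCount (3 ℕ.* n ℕ.∸ i) j
    rising-part : Σ M (λ i → fromℕ 𝟙[ c ≤ i ] * rootTerm n i) ≡ Σ (suc n) (λ j → fromℕ (shrubCount (M ℕ.∸ c) (suc j)) * Y j)
    rising-part = begin
        Σ M (λ i → δ i * rootTerm n i)
      ≡⟨ Σ-cong M (λ i _ → cong (λ z → δ i * (pairs i * z)) (riseSum-expansion n i)) ⟩
        Σ M (λ i → δ i * (pairs i * Σ (suc n) (λ j → count i j * Y j)))
      ≡⟨ Σ-cong M (λ i _ → trans (cong (δ i *_) (Σ-*ˡ (suc n) (pairs i) (λ j → count i j * Y j)))
                                 (Σ-*ˡ (suc n) (δ i) (λ j → pairs i * (count i j * Y j)))) ⟩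
        Σ M (λ i → Σ (suc n) (λ j → δ i * (pairs i * (count i j * Y j))))
      ≡⟨ Σ-comm M (suc n) _ ⟩
        Σ (suc n) (λ j → Σ M (λ i → δ i * (pairs i * (count i j * Y j))))
      ≡⟨ Σ-cong (suc n) (λ j _ → trans (Σ-cong M (λ i _ → merge i j)) (sym (Σ-*ʳ M (Y j) _))) ⟩
        Σ (suc n) (λ j → Σ M (λ i → fromℕ (𝟙[ c ≤ i ] ℕ.* (orderedPairs (2 ℕ.+ 3 ℕ.* n ℕ.∸ i) ℕ.* shrubCount (3 ℕ.* n ℕ.∸ i) j))) * Y j)
      ≡⟨ Σ-cong (suc n) (λ j _ → cong (_* Y j) (trans (sym (fromℕ-Σℕ M _)) (cong fromℕ (inner j)))) ⟩
        Σ (suc n) (λ j → fromℕ (shrubCount (M ℕ.∸ c) (suc j)) * Y j)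
      ∎
      where
      δ pairs : ℕ → ℚ
      δ i = fromℕ 𝟙[ c ≤ i ]
      pairs i = fromℕ (orderedPairs (2 ℕ.+ 3 ℕ.* n ℕ.∸ i))
      count : ℕ → ℕ → ℚ
      count i j = fromℕ (shrubCount (3 ℕ.* n ℕ.∸ i) j)

  expCoeff : ℕ → ℚ
  expCoeff p = (x-1 * (+ 1 ℚ./ 3)) ^ℚ p * invFact p

  egfCoeff : ℕ → ℚ
  egfCoeff n = forestSum n * invFact (3 ℕ.* n)

  -- riseSum-expansion at c = 0, where every root rises.
  egfCoeff-recurrence : ∀ q → Σ (suc (suc q)) (λ n → egfCoeff n * expCoeff (suc q ℕ.∸ n)) ≡ x * egfCoeff (suc q)
  egfCoeff-recurrence q′ = begin
      Σ (suc q) (λ n → egfCoeff n * expCoeff (q ℕ.∸ n))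
    ≡⟨ Σ-reverse (suc q) _ ⟩
      Σ (suc q) (λ j → egfCoeff (q ℕ.∸ j) * expCoeff (q ℕ.∸ (q ℕ.∸ j)))
    ≡⟨ Σ-cong (suc q) (λ j j≤q → cong (λ i → egfCoeff (q ℕ.∸ j) * expCoeff i) (ℕP.m∸[m∸n]≡n (ℕP.≤-pred j≤q))) ⟩
      Σ (suc q) (λ j → egfCoeff (q ℕ.∸ j) * expCoeff j)
    ≡⟨ Σ-cong (suc q) (λ j j≤q → sym (term j (ℕP.≤-pred j≤q))) ⟩
      Σ (suc q) (λ j → invFact (3 ℕ.* q) * (fromℕ (shrubCount (3 ℕ.* q) j) * (x-1 ^ℚ j * forestSum (q ℕ.∸ j))))
    ≡⟨ sym (Σ-*ˡ (suc q) (invFact (3 ℕ.* q)) _) ⟩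
      invFact (3 ℕ.* q) * Σ (suc q) (λ j → fromℕ (shrubCount (3 ℕ.* q) j) * (x-1 ^ℚ j * forestSum (q ℕ.∸ j)))
    ≡⟨ cong (invFact (3 ℕ.* q) *_) (sym (riseSum-expansion q 0)) ⟩
      invFact (3 ℕ.* q) * riseSum q 0
    ≡⟨ cong (invFact (3 ℕ.* q) *_) (riseSum-suc-0 q′) ⟩
      invFact (3 ℕ.* q) * (x * forestSum q)
    ≡⟨ solve 3 (λ i x a → i :* (x :* a) := x :* (a :* i)) refl (invFact (3 ℕ.* q)) x (forestSum q) ⟩
      x * egfCoeff q
    ∎
    where
    open ≡-Reasoning
    q = suc q′
    term : ∀ j → j ≤ q →
      invFact (3 ℕ.* q) * (fromℕ (shrubCount (3 ℕ.* q) j) * (x-1 ^ℚ j * forestSum (q ℕ.∸ j))) ≡ egfCoeff (q ℕ.∸ j) * expCoeff j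
    term j j≤q = begin
        invFact (3 ℕ.* q) * (fromℕ (shrubCount (3 ℕ.* q) j) * (x-1 ^ℚ j * forestSum (q ℕ.∸ j)))
      ≡⟨ sym (ℚP.*-assoc (invFact (3 ℕ.* q)) (fromℕ (shrubCount (3 ℕ.* q) j)) (x-1 ^ℚ j * forestSum (q ℕ.∸ j))) ⟩
        (invFact (3 ℕ.* q) * fromℕ (shrubCount (3 ℕ.* q) j)) * (x-1 ^ℚ j * forestSum (q ℕ.∸ j))
      ≡⟨ cong (_* (x-1 ^ℚ j * forestSum (q ℕ.∸ j))) (invFact-shrubCount q j j≤q) ⟩
        (invFact (3 ℕ.* (q ℕ.∸ j)) * ((+ 1 ℚ./ 3) ^ℚ j * invFact j)) * (x-1 ^ℚ j * forestSum (q ℕ.∸ j))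
      ≡⟨ solve 5 (λ I T J Y A → (I :* (T :* J)) :* (Y :* A) := (A :* I) :* ((Y :* T) :* J)) refl
           (invFact (3 ℕ.* (q ℕ.∸ j))) ((+ 1 ℚ./ 3) ^ℚ j) (invFact j) (x-1 ^ℚ j) (forestSum (q ℕ.∸ j)) ⟩
        egfCoeff (q ℕ.∸ j) * ((x-1 ^ℚ j * (+ 1 ℚ./ 3) ^ℚ j) * invFact j)
      ≡⟨ cong (λ z → egfCoeff (q ℕ.∸ j) * (z * invFact j)) (sym (^ℚ-distrib-* x-1 (+ 1 ℚ./ 3) j)) ⟩
        egfCoeff (q ℕ.∸ j) * expCoeff j
      ∎

  lhsCoeff-formula : ∀ k → lhsCoeff x k ≡ (if k ℕ.% 3 ℕ.≡ᵇ 0 then forestPoly (k ℕ./ 3) x * invFact k else 0ℚ)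
  lhsCoeff-formula zero    = refl
  lhsCoeff-formula (suc k) = refl

  lhsCoeff-lacunary : Lacunary (lhsCoeff x)
  lhsCoeff-lacunary = record { at-3q+1 = at 1 (s≤s (s≤s z≤n)) ; at-3q+2 = at 2 (s≤s (s≤s (s≤s z≤n))) }
    where
    at : ∀ r → r < 3 → ∀ q → lhsCoeff x (r ℕ.+ 3 ℕ.* q) ≡
         (if r ℕ.≡ᵇ 0 then forestPoly ((r ℕ.+ 3 ℕ.* q) ℕ./ 3) x * invFact (r ℕ.+ 3 ℕ.* q) else 0ℚ)
    at r r<3 q = trans (lhsCoeff-formula (r ℕ.+ 3 ℕ.* q))
      (cong (λ i → if i ℕ.≡ᵇ 0 then forestPoly ((r ℕ.+ 3 ℕ.* q) ℕ./ 3) x * invFact (r ℕ.+ 3 ℕ.* q) else 0ℚ) ([r+3q]%3≡r r q r<3))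

  lhsCoeff-3* : ∀ n → lhsCoeff x (3 ℕ.* n) ≡ forestPoly n x * invFact (3 ℕ.* n)
  lhsCoeff-3* n rewrite lhsCoeff-formula (3 ℕ.* n) | [r+3q]%3≡r 0 n (s≤s z≤n) | 3q/3≡q n = refl

  constCoeff : ℕ → ℚ
  constCoeff zero    = x
  constCoeff (suc _) = 0ℚ

  denCoeff-3* : ∀ p → denCoeff x (3 ℕ.* p) ≡ expCoeff p - constCoeff p
  denCoeff-3* p rewrite [r+3q]%3≡r 0 p (s≤s z≤n) | 3q/3≡q p = cong (λ c → expCoeff p - c) (constant p)
    where
    constant : ∀ p → (if 3 ℕ.* p ℕ.≡ᵇ 0 then x else 0ℚ) ≡ constCoeff p
    constant zero    = refl
    constant (suc p) = refl

  denCoeff-lacunary : Lacunary (denCoeff x)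
  denCoeff-lacunary = record { at-3q+1 = at 1 (s≤s (s≤s z≤n)) ; at-3q+2 = at 2 (s≤s (s≤s (s≤s z≤n))) }
    where
    at : ∀ r → r < 3 → ∀ q → denCoeff x (r ℕ.+ 3 ℕ.* q) ≡
         (if r ℕ.≡ᵇ 0 then expCoeff ((r ℕ.+ 3 ℕ.* q) ℕ./ 3) else 0ℚ) - (if r ℕ.+ 3 ℕ.* q ℕ.≡ᵇ 0 then x else 0ℚ)
    at r r<3 q = cong (λ i → (if i ℕ.≡ᵇ 0 then expCoeff ((r ℕ.+ 3 ℕ.* q) ℕ./ 3) else 0ℚ)
                             - (if r ℕ.+ 3 ℕ.* q ℕ.≡ᵇ 0 then x else 0ℚ))
                    ([r+3q]%3≡r r q r<3)

  Σ-constCoeff : ∀ (f : ℕ → ℚ) q → Σ (suc q) (λ n → f n * constCoeff (q ℕ.∸ n)) ≡ f q * x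
  Σ-constCoeff f q = begin
      Σ q (λ n → f n * constCoeff (q ℕ.∸ n)) + f q * constCoeff (q ℕ.∸ q)
    ≡⟨ cong₂ _+_ (Σ-zero q (λ n n<q → trans (cong (f n *_) (constCoeff-∸ n<q)) (ℚP.*-zeroʳ (f n))))
                 (cong (λ i → f q * constCoeff i) (ℕP.n∸n≡0 q)) ⟩
      0ℚ + f q * x
    ≡⟨ ℚP.+-identityˡ (f q * x) ⟩
      f q * x
    ∎
    where
    open ≡-Reasoning
    constCoeff-∸ : ∀ {q n} → n < q → constCoeff (q ℕ.∸ n) ≡ 0ℚ
    constCoeff-∸ {suc q} {zero}  _             = refl
    constCoeff-∸ {suc q} {suc n} (s≤s n<q) = constCoeff-∸ n<q

  coefficientProduct-3* : ∀ n p → lhsCoeff x (3 ℕ.* n) * denCoeff x (3 ℕ.* p) ≡ egfCoeff n * expCoeff p - egfCoeff n * constCoeff p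
  coefficientProduct-3* n p = begin
      lhsCoeff x (3 ℕ.* n) * denCoeff x (3 ℕ.* p)
    ≡⟨ cong₂ _*_ (trans (lhsCoeff-3* n) (cong (_* invFact (3 ℕ.* n)) (forestPoly≡forestSum n))) (denCoeff-3* p) ⟩
      egfCoeff n * (expCoeff p - constCoeff p)
    ≡⟨ solve 3 (λ g e c → g :* (e :- c) := g :* e :- g :* c) refl (egfCoeff n) (expCoeff p) (constCoeff p) ⟩
      egfCoeff n * expCoeff p - egfCoeff n * constCoeff p
    ∎
    where open ≡-Reasoning

mainTheorem7 : (x : ℚ) (m : ℕ) →
    cauchy (lhsCoeff x) (denCoeff x) m ≡ numCoeff x m
mainTheorem7 x m with mod3 m
... | mod1 q       = at-3q+1 (cauchy-lacunary (lhsCoeff-lacunary x) (denCoeff-lacunary x)) q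
... | mod2 q       = at-3q+2 (cauchy-lacunary (lhsCoeff-lacunary x) (denCoeff-lacunary x)) q
... | mod0 zero    = solve 1 (λ x → con 1ℚ :* (con 1ℚ :- x) :+ con 0ℚ := con 1ℚ :- x) refl x
... | mod0 (suc q) = begin
    cauchy (lhsCoeff x) (denCoeff x) (3 ℕ.* suc q)
  ≡⟨ cauchy-3* (lhsCoeff-lacunary x) (denCoeff x) (suc q) ⟩
    Σ (suc (suc q)) (λ n → lhsCoeff x (3 ℕ.* n) * denCoeff x (3 ℕ.* (suc q ℕ.∸ n)))
  ≡⟨ Σ-cong (suc (suc q)) (λ n _ → coefficientProduct-3* x n (suc q ℕ.∸ n)) ⟩
    Σ (suc (suc q)) (λ n → egfCoeff x n * expCoeff x (suc q ℕ.∸ n) - egfCoeff x n * constCoeff x (suc q ℕ.∸ n))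
  ≡⟨ Σ-- (suc (suc q)) _ _ ⟩
    Σ (suc (suc q)) (λ n → egfCoeff x n * expCoeff x (suc q ℕ.∸ n)) - Σ (suc (suc q)) (λ n → egfCoeff x n * constCoeff x (suc q ℕ.∸ n))
  ≡⟨ cong₂ _-_ (egfCoeff-recurrence x q) (Σ-constCoeff x (egfCoeff x) (suc q)) ⟩
    x * egfCoeff x (suc q) - egfCoeff x (suc q) * x
  ≡⟨ solve 2 (λ x e → x :* e :- e :* x := con 0ℚ) refl x (egfCoeff x (suc q)) ⟩
    0ℚ
  ∎
  where open ≡-Reasoning
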